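{- Let $\lambda=(\lambda_1,\lambda_2,\lambda_3)$ be a good triple. Then $Q(\lambda)$ is not normal, and every hole $q\in\overline{Q}(\lambda)\setminus Q(\lambda)$ satisfies $\sigma_\lambda(q)\ge\lambda_1+2$.
   Context: A triple $(\lambda_1,\lambda_2,\lambda_3)$ of positive integers with $\lambda_1\le\lambda_2\le\lambda_3$ is a good triple if (1) $\lambda_1,\lambda_2,\lambda_3$ are pairwise coprime; (2) $\lambda_2\lambda_3-2\lambda_1\lambda_3+\lambda_1\lambda_2=2$; (3) $\lambda_1+2<\lambda_2$. $Q(\lambda)\subset\mathbb{Z}^4$ is the affine semigroup generated by all points $(p,1)$ with $p\in\mathbb{Z}^3$ lying in the simplex with vertices $0,\lambda_1e_1,\lambda_2e_2,\lambda_3e_3$; its normalization is $\overline{Q}(\lambda)=\mathbb{Z}^4\cap\mathbb{R}_{\ge0}Q(\lambda)$, normality means $Q(\lambda)=\overline{Q}(\lambda)$, and holes are elements of $\overline{Q}(\lambda)\setminus Q(\lambda)$. Here $\sigma_\lambda(z)=Lz_4-\sum_{i=1}^3\frac{L}{\lambda_i}z_i$ with $L=\operatorname{lcm}(\lambda_1,\lambda_2,\lambda_3)$ is the lattice height above the facet spanned by $\lambda_ie_i+e_4$, $i=1,2,3$.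
   Formalization: The cone $\mathbb{R}_{\ge0}Q(\lambda)$ defining the normalization $\overline{Q}(\lambda)$ is taken with nonnegative rational coefficients rather than real ones. -}

module Defs where

open import Data.Nat as ℕ using (ℕ; NonZero)
open import Data.Nat.Coprimality using (Coprime)
open import Data.Nat.LCM using (lcm)
open import Data.Integer as ℤ using (ℤ; +_)
open import Data.Rational as ℚ using (ℚ)
open import Data.List using (List; []; _∷_)
open import Data.List.Relation.Unary.All using (All)
open import Data.Product using (Σ; _×_; _,_; ∃)
open import Relation.Binary.PropositionalEquality using (_≡_)
open import Relation.Nullary using (¬_)

record Z4 : Set where
  constructor ⟨_,_,_,_⟩
  field
    c1 c2 c3 c4 : ℤ
open Z4 public

zero4 : Z4
zero4 = ⟨ + 0 , + 0 , + 0 , + 0 ⟩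

_⊕_ : Z4 → Z4 → Z4
x ⊕ y = ⟨ c1 x ℤ.+ c1 y , c2 x ℤ.+ c2 y , c3 x ℤ.+ c3 y , c4 x ℤ.+ c4 y ⟩

record GoodTriple (l1 l2 l3 : ℕ) : Set where
  field
    pos1 : 0 ℕ.< l1
    pos2 : 0 ℕ.< l2
    pos3 : 0 ℕ.< l3
    ord12 : l1 ℕ.≤ l2
    ord23 : l2 ℕ.≤ l3
    cop12 : Coprime l1 l2
    cop13 : Coprime l1 l3
    cop23 : Coprime l2 l3
    eqn : (+ l2 ℤ.* + l3) ℤ.- (+ 2 ℤ.* + l1 ℤ.* + l3) ℤ.+ (+ l1 ℤ.* + l2) ≡ + 2
    gap : l1 ℕ.+ 2 ℕ.< l2

module _ (l1 l2 l3 : ℕ) .{{_ : NonZero l1}} .{{_ : NonZero l2}} .{{_ : NonZero l3}} where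

  L : ℕ
  L = lcm l1 (lcm l2 l3)

  -- p ∈ ℤ³ lies in the simplex conv(0, λ₁e₁, λ₂e₂, λ₃e₃):
  -- p ≥ 0 and p₁/λ₁ + p₂/λ₂ + p₃/λ₃ ≤ 1 (cleared by L)
  InSimplex : ℤ → ℤ → ℤ → Set
  InSimplex p1 p2 p3 =
    (+ 0 ℤ.≤ p1) × (+ 0 ℤ.≤ p2) × (+ 0 ℤ.≤ p3) ×
    (+ (L ℕ./ l1) ℤ.* p1 ℤ.+ + (L ℕ./ l2) ℤ.* p2 ℤ.+ + (L ℕ./ l3) ℤ.* p3 ℤ.≤ + L)

  Generator : Z4 → Set
  Generator z = InSimplex (c1 z) (c2 z) (c3 z) × (c4 z ≡ + 1)

  data InQ : Z4 → Set where
    q-zero : InQ zero4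
    q-add  : ∀ {g z} → Generator g → InQ z → InQ (g ⊕ z)

  toℚ : ℤ → ℚ
  toℚ z = z ℚ./ 1

  combo : (Z4 → ℤ) → List (ℚ × Z4) → ℚ
  combo f [] = ℚ.0ℚ
  combo f ((c , g) ∷ cs) = c ℚ.* toℚ (f g) ℚ.+ combo f cs

  -- z lies in the cone ℝ≥0 Q(λ) (nonnegative (rational) combination of elements of Q(λ))
  InCone : Z4 → Set
  InCone z = Σ (List (ℚ × Z4)) λ cs →
    All (λ cg → (ℚ.0ℚ ℚ.≤ Data.Product.proj₁ cg) × InQ (Data.Product.proj₂ cg)) cs ×
    (toℚ (c1 z) ≡ combo c1 cs) × (toℚ (c2 z) ≡ combo c2 cs) ×
    (toℚ (c3 z) ≡ combo c3 cs) × (toℚ (c4 z) ≡ combo c4 cs)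

  -- normalization  \overline{Q}(λ) = ℤ⁴ ∩ ℝ≥0 Q(λ)
  InNormalization : Z4 → Set
  InNormalization = InCone

  Normal : Set
  Normal = ∀ z → InNormalization z → InQ z

  Hole : Z4 → Set
  Hole z = InNormalization z × ¬ InQ z

  σ : Z4 → ℤ
  σ z = + L ℤ.* c4 z ℤ.- (+ (L ℕ./ l1) ℤ.* c1 z ℤ.+ + (L ℕ./ l2) ℤ.* c2 z ℤ.+ + (L ℕ./ l3) ℤ.* c3 z)

-- For pairwise coprime λ we have L = λ₁λ₂λ₃, and σ(z) = ν · z for the normal vector
-- ν = (-λ₂λ₃, -λ₁λ₃, -λ₁λ₂, λ₁λ₂λ₃); the cone is cut out by z₁, z₂, z₃ ≥ 0 and σ ≥ 0.  Coprimality
-- also makes a point with 0 ≤ zᵢ < λᵢ (i = 1, 2, 3) unique given its height σ, and every point with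
-- z₁, z₂, z₃ ≥ 0 is such a reduced point plus a combination of the vertices λᵢeᵢ + e₄, which have
-- height 0.  The equation of a good triple forces λ₁ = 2α + 1 and λ₃ = 2(α + 1 + δ) + 1 to be odd.
-- The generators (e, 2t + 1, e + 1 + δ, 1) with t + e = α have height 2t + 1, and sums of two of
-- them reach the heights 2t + 2, so every reduced point of height at most λ₁ + 1 lies in Q, and a
-- reduced generator of such height has odd height.  Hence a hole has height at least λ₁ + 2.  The
-- point (2α, λ₁ + 2, δ, 2) of the cone has the odd height λ₁ + 2, while a decomposition into two
-- generators would have reduced summands whose heights are both odd (or one is 0): it is a hole.

module Submission where

open import Defs
open import Data.Nat as ℕ using (ℕ; NonZero; zero; suc)
open import Data.Integer as ℤ using (ℤ; +_; -[1+_])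
open import Data.Product using (Σ; _×_; _,_; proj₁; proj₂)
open import Data.Sum using (_⊎_; inj₁; inj₂)
open import Data.Nat.Coprimality as Coprimality using (Coprime)
open import Data.Nat.Divisibility using (_∣_; divides; ∣-trans; ∣⇒≤)
open import Data.Nat.LCM using (lcm; gcd*lcm)
open import Data.Nat.DivMod using (m*n/n≡m; m≡m%n+[m/n]*n; m%n<n)
open import Relation.Binary.PropositionalEquality
open import Relation.Nullary using (¬_; yes; no)
open import Data.Empty using (⊥; ⊥-elim)
open import Function using (_∘_)
import Data.Nat.Properties as ℕP
import Data.Integer.Properties as ℤP
import Data.Integer.Tactic.RingSolver as ℤ-Solver
import Data.Nat.Tactic.RingSolver as ℕ-Solver
open import Data.Rational as ℚ using (ℚ)
import Data.Rational.Properties as ℚP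
import Data.Rational.Solver as ℚ-Solver
import Data.Rational.Unnormalised as ℚᵘ
import Data.Rational.Unnormalised.Properties as ℚᵘP
open import Data.List using ([]; _∷_)
open import Data.List.Relation.Unary.All using (All; []; _∷_)

0≤+ : ∀ n → + 0 ℤ.≤ + n
0≤+ n = ℤ.+≤+ ℕ.z≤n

halve : ∀ {h c} → + 2 ℤ.* h ≡ c ℤ.* + 2 → h ≡ c
halve {h} {c} 2h≡2c = ℤP.*-cancelˡ-≡ (+ 2) h c (trans 2h≡2c (ℤP.*-comm c (+ 2)))

nonNeg-summands : ∀ {x y n} → + 0 ℤ.≤ x → + 0 ℤ.≤ y → x ℤ.+ (y ℤ.+ + 0) ≡ + n →
                  Σ ℕ λ a → Σ ℕ λ b → (x ≡ + a) × (y ≡ + b) × (a ℕ.+ b ≡ n)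
nonNeg-summands (ℤ.+≤+ {n = a} _) (ℤ.+≤+ {n = b} _) sum≡n =
  a , b , refl , refl , ℤP.+-injective (trans (ℤP.pos-+ a b) (trans (cong (ℤ._+_ (+ a)) (sym (ℤP.+-identityʳ (+ b)))) sum≡n))

m+n≡o⇒m≤o : ∀ {m n o} → m ℕ.+ n ≡ o → m ℕ.≤ o
m+n≡o⇒m≤o {m} m+n≡o = ℕP.m+n≤o⇒m≤o m (ℕP.≤-reflexive m+n≡o)

m+n≡o⇒n≤o : ∀ {m n o} → m ℕ.+ n ≡ o → n ℕ.≤ o
m+n≡o⇒n≤o {m} m+n≡o = ℕP.m+n≤o⇒n≤o m (ℕP.≤-reflexive m+n≡o)

Z4-ext : ∀ {a1 a2 a3 a4 b1 b2 b3 b4} → a1 ≡ b1 → a2 ≡ b2 → a3 ≡ b3 → a4 ≡ b4 →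
         ⟨ a1 , a2 , a3 , a4 ⟩ ≡ ⟨ b1 , b2 , b3 , b4 ⟩
Z4-ext refl refl refl refl = refl

⊕-identityˡ : ∀ z → zero4 ⊕ z ≡ z
⊕-identityˡ ⟨ z1 , z2 , z3 , z4 ⟩ = Z4-ext (ℤP.+-identityˡ z1) (ℤP.+-identityˡ z2) (ℤP.+-identityˡ z3) (ℤP.+-identityˡ z4)

⊕-identityʳ : ∀ z → z ⊕ zero4 ≡ z
⊕-identityʳ ⟨ z1 , z2 , z3 , z4 ⟩ = Z4-ext (ℤP.+-identityʳ z1) (ℤP.+-identityʳ z2) (ℤP.+-identityʳ z3) (ℤP.+-identityʳ z4)

⊕-assoc : ∀ x y z → (x ⊕ y) ⊕ z ≡ x ⊕ (y ⊕ z)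
⊕-assoc ⟨ x1 , x2 , x3 , x4 ⟩ ⟨ y1 , y2 , y3 , y4 ⟩ ⟨ z1 , z2 , z3 , z4 ⟩ =
  Z4-ext (ℤP.+-assoc x1 y1 z1) (ℤP.+-assoc x2 y2 z2) (ℤP.+-assoc x3 y3 z3) (ℤP.+-assoc x4 y4 z4)

_⊙_ : ℕ → Z4 → Z4
zero  ⊙ z = zero4
suc n ⊙ z = z ⊕ (n ⊙ z)

additive-⊙ : (p : Z4 → ℤ) → p zero4 ≡ + 0 → (∀ x y → p (x ⊕ y) ≡ p x ℤ.+ p y) →
             ∀ n z → p (n ⊙ z) ≡ + n ℤ.* p z
additive-⊙ p p0 p⊕ zero    z = trans p0 (sym (ℤP.*-zeroˡ (p z)))
additive-⊙ p p0 p⊕ (suc n) z = begin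
  p (z ⊕ (n ⊙ z))          ≡⟨ p⊕ z (n ⊙ z) ⟩
  p z ℤ.+ p (n ⊙ z)        ≡⟨ cong (ℤ._+_ (p z)) (additive-⊙ p p0 p⊕ n z) ⟩
  p z ℤ.+ + n ℤ.* p z      ≡⟨ sym (ℤP.suc-* (+ n) (p z)) ⟩
  + suc n ℤ.* p z          ∎
  where open ≡-Reasoning

⊙-coordinates : ∀ n z → n ⊙ z ≡ ⟨ + n ℤ.* c1 z , + n ℤ.* c2 z , + n ℤ.* c3 z , + n ℤ.* c4 z ⟩
⊙-coordinates n z = Z4-ext (additive-⊙ c1 refl (λ _ _ → refl) n z) (additive-⊙ c2 refl (λ _ _ → refl) n z)
                           (additive-⊙ c3 refl (λ _ _ → refl) n z) (additive-⊙ c4 refl (λ _ _ → refl) n z)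

-- The ring solver does not unfold definitions, so the identities below restate `_·_` and
-- `facetNormal` unfolded before instantiating them.
infix 8 _·_
_·_ : Z4 → Z4 → ℤ
a · z = c1 a ℤ.* c1 z ℤ.+ c2 a ℤ.* c2 z ℤ.+ c3 a ℤ.* c3 z ℤ.+ c4 a ℤ.* c4 z

·-zeroʳ : ∀ a → a · zero4 ≡ + 0
·-zeroʳ a = identity (c1 a) (c2 a) (c3 a) (c4 a)
  where
  identity : ∀ a1 a2 a3 a4 → a1 ℤ.* + 0 ℤ.+ a2 ℤ.* + 0 ℤ.+ a3 ℤ.* + 0 ℤ.+ a4 ℤ.* + 0 ≡ + 0
  identity = ℤ-Solver.solve-∀

·-distribˡ-⊕ : ∀ a x y → a · (x ⊕ y) ≡ a · x ℤ.+ a · y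
·-distribˡ-⊕ a x y = identity (c1 a) (c2 a) (c3 a) (c4 a) (c1 x) (c2 x) (c3 x) (c4 x) (c1 y) (c2 y) (c3 y) (c4 y)
  where
  identity : ∀ a1 a2 a3 a4 x1 x2 x3 x4 y1 y2 y3 y4 →
    a1 ℤ.* (x1 ℤ.+ y1) ℤ.+ a2 ℤ.* (x2 ℤ.+ y2) ℤ.+ a3 ℤ.* (x3 ℤ.+ y3) ℤ.+ a4 ℤ.* (x4 ℤ.+ y4) ≡
    (a1 ℤ.* x1 ℤ.+ a2 ℤ.* x2 ℤ.+ a3 ℤ.* x3 ℤ.+ a4 ℤ.* x4) ℤ.+ (a1 ℤ.* y1 ℤ.+ a2 ℤ.* y2 ℤ.+ a3 ℤ.* y3 ℤ.+ a4 ℤ.* y4)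
  identity = ℤ-Solver.solve-∀

·-⊙ : ∀ a n z → a · (n ⊙ z) ≡ + n ℤ.* (a · z)
·-⊙ a = additive-⊙ (a ·_) (·-zeroʳ a) (·-distribˡ-⊕ a)

e₁ e₂ e₃ e₄ : Z4
e₁ = ⟨ + 1 , + 0 , + 0 , + 0 ⟩
e₂ = ⟨ + 0 , + 1 , + 0 , + 0 ⟩
e₃ = ⟨ + 0 , + 0 , + 1 , + 0 ⟩
e₄ = ⟨ + 0 , + 0 , + 0 , + 1 ⟩

e₁·z≡c1 : ∀ z → e₁ · z ≡ c1 z
e₁·z≡c1 z = identity (c1 z) (c2 z) (c3 z) (c4 z)
  where
  identity : ∀ z1 z2 z3 z4 → + 1 ℤ.* z1 ℤ.+ + 0 ℤ.* z2 ℤ.+ + 0 ℤ.* z3 ℤ.+ + 0 ℤ.* z4 ≡ z1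
  identity = ℤ-Solver.solve-∀

e₂·z≡c2 : ∀ z → e₂ · z ≡ c2 z
e₂·z≡c2 z = identity (c1 z) (c2 z) (c3 z) (c4 z)
  where
  identity : ∀ z1 z2 z3 z4 → + 0 ℤ.* z1 ℤ.+ + 1 ℤ.* z2 ℤ.+ + 0 ℤ.* z3 ℤ.+ + 0 ℤ.* z4 ≡ z2
  identity = ℤ-Solver.solve-∀

e₃·z≡c3 : ∀ z → e₃ · z ≡ c3 z
e₃·z≡c3 z = identity (c1 z) (c2 z) (c3 z) (c4 z)
  where
  identity : ∀ z1 z2 z3 z4 → + 0 ℤ.* z1 ℤ.+ + 0 ℤ.* z2 ℤ.+ + 1 ℤ.* z3 ℤ.+ + 0 ℤ.* z4 ≡ z3
  identity = ℤ-Solver.solve-∀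

e₄·z≡c4 : ∀ z → e₄ · z ≡ c4 z
e₄·z≡c4 z = identity (c1 z) (c2 z) (c3 z) (c4 z)
  where
  identity : ∀ z1 z2 z3 z4 → + 0 ℤ.* z1 ℤ.+ + 0 ℤ.* z2 ℤ.+ + 0 ℤ.* z3 ℤ.+ + 1 ℤ.* z4 ≡ z4
  identity = ℤ-Solver.solve-∀

fromℤ : ℤ → ℚ
fromℤ i = i ℚ./ 1

private
  toℚᵘ-fromℤ : ∀ i → ℚ.toℚᵘ (fromℤ i) ℚᵘ.≃ ℚᵘ.mkℚᵘ i 0
  toℚᵘ-fromℤ i = ℚP.toℚᵘ-fromℚᵘ (ℚᵘ.mkℚᵘ i 0)

fromℤ-homo-+ : ∀ i j → fromℤ (i ℤ.+ j) ≡ fromℤ i ℚ.+ fromℤ j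
fromℤ-homo-+ i j = ℚP.toℚᵘ-injective (ℚᵘP.≃-trans (toℚᵘ-fromℤ (i ℤ.+ j))
  (ℚᵘP.≃-trans (ℚᵘ.*≡* (identity i j))
    (ℚᵘP.≃-sym (ℚᵘP.≃-trans (ℚP.toℚᵘ-homo-+ (fromℤ i) (fromℤ j)) (ℚᵘP.+-cong (toℚᵘ-fromℤ i) (toℚᵘ-fromℤ j))))))
  where
  identity : ∀ i j → (i ℤ.+ j) ℤ.* + 1 ≡ (i ℤ.* + 1 ℤ.+ j ℤ.* + 1) ℤ.* + 1
  identity = ℤ-Solver.solve-∀

fromℤ-homo-* : ∀ i j → fromℤ (i ℤ.* j) ≡ fromℤ i ℚ.* fromℤ j
fromℤ-homo-* i j = ℚP.toℚᵘ-injective (ℚᵘP.≃-trans (toℚᵘ-fromℤ (i ℤ.* j))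
  (ℚᵘP.≃-sym (ℚᵘP.≃-trans (ℚP.toℚᵘ-homo-* (fromℤ i) (fromℤ j)) (ℚᵘP.*-cong (toℚᵘ-fromℤ i) (toℚᵘ-fromℤ j)))))

fromℤ-nonNeg⁺ : ∀ {i} → + 0 ℤ.≤ i → ℚ.0ℚ ℚ.≤ fromℤ i
fromℤ-nonNeg⁺ {i} 0≤i = ℚP.toℚᵘ-cancel-≤
  (ℚᵘP.≤-respʳ-≃ (ℚᵘP.≃-sym (toℚᵘ-fromℤ i)) (ℚᵘ.*≤* (ℤP.*-monoʳ-≤-nonNeg (+ 1) 0≤i)))

fromℤ-nonNeg⁻ : ∀ {i} → ℚ.0ℚ ℚ.≤ fromℤ i → + 0 ℤ.≤ i
fromℤ-nonNeg⁻ {i} 0≤i with ℚᵘP.≤-respʳ-≃ (toℚᵘ-fromℤ i) (ℚP.toℚᵘ-mono-≤ 0≤i)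
... | ℚᵘ.*≤* le = subst (+ 0 ℤ.≤_) (ℤP.*-identityʳ i) le

fromℤ-·-expand : ∀ a z → fromℤ (a · z) ≡
  fromℤ (c1 a) ℚ.* fromℤ (c1 z) ℚ.+ fromℤ (c2 a) ℚ.* fromℤ (c2 z) ℚ.+ fromℤ (c3 a) ℚ.* fromℤ (c3 z) ℚ.+ fromℤ (c4 a) ℚ.* fromℤ (c4 z)
fromℤ-·-expand ⟨ a1 , a2 , a3 , a4 ⟩ ⟨ z1 , z2 , z3 , z4 ⟩ =
  trans (fromℤ-homo-+ (a1 ℤ.* z1 ℤ.+ a2 ℤ.* z2 ℤ.+ a3 ℤ.* z3) (a4 ℤ.* z4)) (cong₂ ℚ._+_
    (trans (fromℤ-homo-+ (a1 ℤ.* z1 ℤ.+ a2 ℤ.* z2) (a3 ℤ.* z3)) (cong₂ ℚ._+_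
      (trans (fromℤ-homo-+ (a1 ℤ.* z1) (a2 ℤ.* z2)) (cong₂ ℚ._+_ (fromℤ-homo-* a1 z1) (fromℤ-homo-* a2 z2)))
      (fromℤ-homo-* a3 z3)))
    (fromℤ-homo-* a4 z4))

fromℤ-nonNeg-* : ∀ {p} i → ℚ.0ℚ ℚ.≤ p → + 0 ℤ.≤ i → ℚ.0ℚ ℚ.≤ p ℚ.* fromℤ i
fromℤ-nonNeg-* {p} i 0≤p 0≤i =
  subst (ℚ._≤ p ℚ.* fromℤ i) (ℚP.*-zeroʳ p) (ℚP.*-monoˡ-≤-nonNeg p {{ℚ.nonNegative 0≤p}} (fromℤ-nonNeg⁺ 0≤i))

1/[1+n]*[1+n]≡1 : ∀ n → (+ 1 ℚ./ suc n) ℚ.* fromℤ (+ suc n) ≡ ℚ.1ℚ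
1/[1+n]*[1+n]≡1 n = ℚP.toℚᵘ-injective (ℚᵘP.≃-trans (ℚP.toℚᵘ-homo-* (+ 1 ℚ./ suc n) (fromℤ (+ suc n)))
  (ℚᵘP.≃-trans (ℚᵘP.*-cong (ℚP.toℚᵘ-fromℚᵘ (ℚᵘ.mkℚᵘ (+ 1) n)) (toℚᵘ-fromℤ (+ suc n)))
    (ℚᵘ.*≡* (cong (λ m → + suc m) (identity n)))))
  where
  identity : ∀ n → (n ℕ.+ 0 ℕ.* suc n) ℕ.* 1 ≡ n ℕ.* 1 ℕ.+ 0 ℕ.* suc (n ℕ.* 1)
  identity = ℕ-Solver.solve-∀

-- The semigroup Q(λ) and its cone

module _ (l1 l2 l3 : ℕ) .{{_ : NonZero l1}} .{{_ : NonZero l2}} .{{_ : NonZero l3}} where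

  InQ-⊕ : ∀ {x y} → InQ l1 l2 l3 x → InQ l1 l2 l3 y → InQ l1 l2 l3 (x ⊕ y)
  InQ-⊕ {y = y} q-zero qy = subst (InQ l1 l2 l3) (sym (⊕-identityˡ y)) qy
  InQ-⊕ {y = y} (q-add {g} {z} G qz) qy = subst (InQ l1 l2 l3) (sym (⊕-assoc g z y)) (q-add G (InQ-⊕ qz qy))

  InQ-generator : ∀ {g} → Generator l1 l2 l3 g → InQ l1 l2 l3 g
  InQ-generator {g} G = subst (InQ l1 l2 l3) (⊕-identityʳ g) (q-add G q-zero)

  InQ-⊙ : ∀ n {g} → Generator l1 l2 l3 g → InQ l1 l2 l3 (n ⊙ g)
  InQ-⊙ zero    G = q-zero
  InQ-⊙ (suc n) G = q-add G (InQ-⊙ n G)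

  InQ-nonNeg : ∀ a → (∀ {g} → Generator l1 l2 l3 g → + 0 ℤ.≤ a · g) →
               ∀ {z} → InQ l1 l2 l3 z → + 0 ℤ.≤ a · z
  InQ-nonNeg a gen q-zero = ℤP.≤-reflexive (sym (·-zeroʳ a))
  InQ-nonNeg a gen (q-add {g} {z} G q) =
    subst (+ 0 ℤ.≤_) (sym (·-distribˡ-⊕ a g z)) (ℤP.+-mono-≤ (gen G) (InQ-nonNeg a gen q))

  combo-· : ∀ a cs → combo l1 l2 l3 (a ·_) cs ≡
    fromℤ (c1 a) ℚ.* combo l1 l2 l3 c1 cs ℚ.+ fromℤ (c2 a) ℚ.* combo l1 l2 l3 c2 cs ℚ.+
    fromℤ (c3 a) ℚ.* combo l1 l2 l3 c3 cs ℚ.+ fromℤ (c4 a) ℚ.* combo l1 l2 l3 c4 cs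
  combo-· a [] = sym (identity (fromℤ (c1 a)) (fromℤ (c2 a)) (fromℤ (c3 a)) (fromℤ (c4 a)))
    where
    open ℚ-Solver.+-*-Solver
    identity : ∀ a1 a2 a3 a4 → a1 ℚ.* ℚ.0ℚ ℚ.+ a2 ℚ.* ℚ.0ℚ ℚ.+ a3 ℚ.* ℚ.0ℚ ℚ.+ a4 ℚ.* ℚ.0ℚ ≡ ℚ.0ℚ
    identity = solve 4 (λ a1 a2 a3 a4 → a1 :* con ℚ.0ℚ :+ a2 :* con ℚ.0ℚ :+ a3 :* con ℚ.0ℚ :+ a4 :* con ℚ.0ℚ := con ℚ.0ℚ) refl
  combo-· a ((c , g) ∷ cs) rewrite fromℤ-·-expand a g | combo-· a cs =
    identity c (fromℤ (c1 a)) (fromℤ (c2 a)) (fromℤ (c3 a)) (fromℤ (c4 a))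
             (fromℤ (c1 g)) (fromℤ (c2 g)) (fromℤ (c3 g)) (fromℤ (c4 g)) _ _ _ _
    where
    open ℚ-Solver.+-*-Solver
    identity : ∀ c a1 a2 a3 a4 g1 g2 g3 g4 s1 s2 s3 s4 →
      c ℚ.* (a1 ℚ.* g1 ℚ.+ a2 ℚ.* g2 ℚ.+ a3 ℚ.* g3 ℚ.+ a4 ℚ.* g4) ℚ.+ (a1 ℚ.* s1 ℚ.+ a2 ℚ.* s2 ℚ.+ a3 ℚ.* s3 ℚ.+ a4 ℚ.* s4) ≡
      a1 ℚ.* (c ℚ.* g1 ℚ.+ s1) ℚ.+ a2 ℚ.* (c ℚ.* g2 ℚ.+ s2) ℚ.+ a3 ℚ.* (c ℚ.* g3 ℚ.+ s3) ℚ.+ a4 ℚ.* (c ℚ.* g4 ℚ.+ s4)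
    identity = solve 13 (λ c a1 a2 a3 a4 g1 g2 g3 g4 s1 s2 s3 s4 →
      c :* (a1 :* g1 :+ a2 :* g2 :+ a3 :* g3 :+ a4 :* g4) :+ (a1 :* s1 :+ a2 :* s2 :+ a3 :* s3 :+ a4 :* s4) :=
      a1 :* (c :* g1 :+ s1) :+ a2 :* (c :* g2 :+ s2) :+ a3 :* (c :* g3 :+ s3) :+ a4 :* (c :* g4 :+ s4)) refl

  combo-nonNeg : ∀ (f : Z4 → ℤ) → (∀ {z} → InQ l1 l2 l3 z → + 0 ℤ.≤ f z) → ∀ cs →
    All (λ cg → (ℚ.0ℚ ℚ.≤ proj₁ cg) × InQ l1 l2 l3 (proj₂ cg)) cs → ℚ.0ℚ ℚ.≤ combo l1 l2 l3 f cs
  combo-nonNeg f f≥0 [] [] = ℚP.≤-refl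
  combo-nonNeg f f≥0 ((c , g) ∷ cs) ((0≤c , qg) ∷ all) =
    subst (ℚ._≤ c ℚ.* fromℤ (f g) ℚ.+ combo l1 l2 l3 f cs) (ℚP.+-identityʳ ℚ.0ℚ) (ℚP.+-mono-≤ (fromℤ-nonNeg-* (f g) 0≤c (f≥0 qg)) (combo-nonNeg f f≥0 cs all))

  InCone-nonNeg : ∀ a → (∀ {z} → InQ l1 l2 l3 z → + 0 ℤ.≤ a · z) →
                  ∀ {z} → InCone l1 l2 l3 z → + 0 ℤ.≤ a · z
  InCone-nonNeg a a≥0 {z} (cs , all , e1 , e2 , e3 , e4) = fromℤ-nonNeg⁻ (subst (ℚ.0ℚ ℚ.≤_) a·z≡combo (combo-nonNeg (a ·_) a≥0 cs all))
    where
    a·z≡combo : combo l1 l2 l3 (a ·_) cs ≡ fromℤ (a · z)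
    a·z≡combo = trans (combo-· a cs) (sym (trans (fromℤ-·-expand a z)
      (cong₂ ℚ._+_ (cong₂ ℚ._+_ (cong₂ ℚ._+_ (cong (fromℤ (c1 a) ℚ.*_) e1) (cong (fromℤ (c2 a) ℚ.*_) e2))
                                 (cong (fromℤ (c3 a) ℚ.*_) e3)) (cong (fromℤ (c4 a) ℚ.*_) e4))))

  InCone-of-multiple : ∀ m .{{_ : NonZero m}} {z} → InQ l1 l2 l3 (m ⊙ z) → InCone l1 l2 l3 z
  InCone-of-multiple (suc n) {z} q = ((+ 1 ℚ./ suc n , suc n ⊙ z) ∷ []) , (0≤1/[1+n] , q) ∷ [] ,
                               unscale (cong c1 n⊙z) , unscale (cong c2 n⊙z) , unscale (cong c3 n⊙z) , unscale (cong c4 n⊙z)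
    where
    n⊙z = ⊙-coordinates (suc n) z
    0≤1/[1+n] : ℚ.0ℚ ℚ.≤ + 1 ℚ./ suc n
    0≤1/[1+n] = ℚP.nonNegative⁻¹ _ {{ℚP.normalize-nonNeg 1 (suc n)}}
    unscale : ∀ {i j} → j ≡ + suc n ℤ.* i → fromℤ i ≡ (+ 1 ℚ./ suc n) ℚ.* fromℤ j ℚ.+ ℚ.0ℚ
    unscale {i} refl = sym (begin
      (+ 1 ℚ./ suc n) ℚ.* fromℤ (+ suc n ℤ.* i) ℚ.+ ℚ.0ℚ    ≡⟨ ℚP.+-identityʳ _ ⟩
      (+ 1 ℚ./ suc n) ℚ.* fromℤ (+ suc n ℤ.* i)              ≡⟨ cong ((+ 1 ℚ./ suc n) ℚ.*_) (fromℤ-homo-* (+ suc n) i) ⟩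
      (+ 1 ℚ./ suc n) ℚ.* (fromℤ (+ suc n) ℚ.* fromℤ i)      ≡⟨ ℚP.*-assoc (+ 1 ℚ./ suc n) (fromℤ (+ suc n)) (fromℤ i) ⟨
      (+ 1 ℚ./ suc n) ℚ.* fromℤ (+ suc n) ℚ.* fromℤ i        ≡⟨ cong (ℚ._* fromℤ i) (1/[1+n]*[1+n]≡1 n) ⟩
      ℚ.1ℚ ℚ.* fromℤ i                                       ≡⟨ ℚP.*-identityˡ (fromℤ i) ⟩
      fromℤ i                                                ∎)
      where open ≡-Reasoning

  private
    weightedSum : Z4 → ℤ
    weightedSum z = + (L l1 l2 l3 ℕ./ l1) ℤ.* c1 z ℤ.+ + (L l1 l2 l3 ℕ./ l2) ℤ.* c2 z ℤ.+ + (L l1 l2 l3 ℕ./ l3) ℤ.* c3 z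

    σ-level-one : ∀ {z} → c4 z ≡ + 1 → σ l1 l2 l3 z ≡ + L l1 l2 l3 ℤ.- weightedSum z
    σ-level-one {z} z4≡1 = cong (ℤ._- weightedSum z) (trans (cong (+ L l1 l2 l3 ℤ.*_) z4≡1) (ℤP.*-identityʳ (+ L l1 l2 l3)))

  generator-intro : ∀ {z} → + 0 ℤ.≤ c1 z → + 0 ℤ.≤ c2 z → + 0 ℤ.≤ c3 z → c4 z ≡ + 1 →
                    + 0 ℤ.≤ σ l1 l2 l3 z → Generator l1 l2 l3 z
  generator-intro 0≤z1 0≤z2 0≤z3 z4≡1 0≤σz =
    (0≤z1 , 0≤z2 , 0≤z3 , ℤP.0≤i-j⇒j≤i (subst (+ 0 ℤ.≤_) (σ-level-one z4≡1) 0≤σz)) , z4≡1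

  generator⇒σ-nonNeg : ∀ {z} → Generator l1 l2 l3 z → + 0 ℤ.≤ σ l1 l2 l3 z
  generator⇒σ-nonNeg ((_ , _ , _ , sum≤L) , z4≡1) = subst (+ 0 ℤ.≤_) (sym (σ-level-one z4≡1)) (ℤP.i≤j⇒0≤j-i sum≤L)

  InQ-level-two : ∀ {z} → InQ l1 l2 l3 z → c4 z ≡ + 2 →
    Σ Z4 λ g → Σ Z4 λ g′ → Generator l1 l2 l3 g × Generator l1 l2 l3 g′ × z ≡ g ⊕ (g′ ⊕ zero4)
  InQ-level-two q-zero ()
  InQ-level-two (q-add (_ , g4≡1) q-zero) z4≡2 = ⊥-elim (one g4≡1 z4≡2)
    where
    one : ∀ {a} → a ≡ + 1 → a ℤ.+ + 0 ≢ + 2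
    one refl ()
  InQ-level-two (q-add {g} G (q-add {g′} G′ q-zero)) _ = g , g′ , G , G′ , refl
  InQ-level-two (q-add (_ , g4≡1) (q-add (_ , g′4≡1) (q-add {z = w} (_ , g″4≡1) w∈Q))) z4≡2 =
    ⊥-elim (three g4≡1 g′4≡1 g″4≡1 (subst (+ 0 ℤ.≤_) (e₄·z≡c4 w) (InQ-nonNeg e₄ level-nonNeg w∈Q)) z4≡2)
    where
    level-nonNeg : ∀ {x} → Generator l1 l2 l3 x → + 0 ℤ.≤ e₄ · x
    level-nonNeg {x} (_ , x4≡1) = subst (+ 0 ℤ.≤_) (sym (trans (e₄·z≡c4 x) x4≡1)) (0≤+ 1)
    three : ∀ {a b c d} → a ≡ + 1 → b ≡ + 1 → c ≡ + 1 → + 0 ℤ.≤ d → a ℤ.+ (b ℤ.+ (c ℤ.+ d)) ≢ + 2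
    three refl refl refl (ℤ.+≤+ _) ()

  InCone⇒nonNeg-coordinates : ∀ {z} → InCone l1 l2 l3 z → (+ 0 ℤ.≤ c1 z) × (+ 0 ℤ.≤ c2 z) × (+ 0 ℤ.≤ c3 z)
  InCone⇒nonNeg-coordinates {z} z∈cone =
    coordinate e₁ e₁·z≡c1 (λ ((0≤g1 , _) , _) → 0≤g1) ,
    coordinate e₂ e₂·z≡c2 (λ ((_ , 0≤g2 , _) , _) → 0≤g2) ,
    coordinate e₃ e₃·z≡c3 (λ ((_ , _ , 0≤g3 , _) , _) → 0≤g3)
    where
    coordinate : ∀ a {c : Z4 → ℤ} → (∀ x → a · x ≡ c x) → (∀ {g} → Generator l1 l2 l3 g → + 0 ℤ.≤ c g) → + 0 ℤ.≤ c z
    coordinate a a·≡c gen = subst (+ 0 ℤ.≤_) (a·≡c z)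
      (InCone-nonNeg a (InQ-nonNeg a (λ {g} G → subst (+ 0 ℤ.≤_) (sym (a·≡c g)) (gen G))) {z} z∈cone)

-- Pairwise coprime triples

coprime-* : ∀ {a b c} → Coprime a b → Coprime a c → Coprime a (b ℕ.* c)
coprime-* {a} {b} a⊥b a⊥c {i} (i∣a , i∣bc) = a⊥c (i∣a , Coprimality.coprime-divisor i⊥b i∣bc)
  where
  i⊥b : Coprime i b
  i⊥b (j∣i , j∣b) = a⊥b (∣-trans j∣i i∣a , j∣b)

lcm-coprime : ∀ {m n} → Coprime m n → lcm m n ≡ m ℕ.* n
lcm-coprime {m} {n} m⊥n = trans (sym (ℕP.*-identityˡ (lcm m n)))
  (trans (cong (ℕ._* lcm m n) (sym (Coprimality.coprime⇒gcd≡1 m⊥n))) (gcd*lcm m n))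

∣m-n∣<l : ∀ {m n l} → m ℕ.< l → n ℕ.< l → ℤ.∣ + m ℤ.- + n ∣ ℕ.< l
∣m-n∣<l {m} {n} m<l n<l rewrite ℤP.[+m]-[+n]≡m⊖n m n with ℕP.≤-total m n
... | inj₁ m≤n rewrite ℤP.∣⊖∣-≤ m≤n = ℕP.≤-<-trans (ℕP.m∸n≤m n m) n<l
... | inj₂ n≤m rewrite ℤP.∣m⊖n∣≡∣n⊖m∣ m n | ℤP.∣⊖∣-≤ n≤m = ℕP.≤-<-trans (ℕP.m∸n≤m m n) m<l

coprime-multiple-small : ∀ {l p q} {d k : ℤ} → Coprime l p → Coprime l q →
                         + p ℤ.* (+ q ℤ.* d) ≡ + l ℤ.* k → ℤ.∣ d ∣ ℕ.< l → d ≡ + 0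
coprime-multiple-small {l} {p} {q} {d} {k} l⊥p l⊥q pqd≡lk ∣d∣<l = ℤP.∣i∣≡0⇒i≡0 (divisor-below l∣d ∣d∣<l)
  where
  l∣d : l ∣ ℤ.∣ d ∣
  l∣d = Coprimality.coprime-divisor l⊥q (Coprimality.coprime-divisor l⊥p (divides ℤ.∣ k ∣ (begin
    p ℕ.* (q ℕ.* ℤ.∣ d ∣)        ≡⟨ cong (p ℕ.*_) (ℤP.abs-* (+ q) d) ⟨
    p ℕ.* ℤ.∣ + q ℤ.* d ∣        ≡⟨ ℤP.abs-* (+ p) (+ q ℤ.* d) ⟨
    ℤ.∣ + p ℤ.* (+ q ℤ.* d) ∣    ≡⟨ cong ℤ.∣_∣ pqd≡lk ⟩
    ℤ.∣ + l ℤ.* k ∣              ≡⟨ ℤP.abs-* (+ l) k ⟩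
    l ℕ.* ℤ.∣ k ∣                ≡⟨ ℕP.*-comm l ℤ.∣ k ∣ ⟩
    ℤ.∣ k ∣ ℕ.* l                ∎)))
    where open ≡-Reasoning
  divisor-below : ∀ {x} → l ∣ x → x ℕ.< l → x ≡ 0
  divisor-below {zero}  _   _   = refl
  divisor-below {suc x} l∣x x<l = ⊥-elim (ℕP.<-irrefl refl (ℕP.<-≤-trans x<l (∣⇒≤ l∣x)))

pos-*³ : ∀ a b c → + (a ℕ.* b ℕ.* c) ≡ + a ℤ.* + b ℤ.* + c
pos-*³ a b c = trans (ℤP.pos-* (a ℕ.* b) c) (cong (ℤ._* + c) (ℤP.pos-* a b))

facetNormal : ℤ → ℤ → ℤ → Z4
facetNormal x1 x2 x3 = ⟨ ℤ.- (x2 ℤ.* x3) , ℤ.- (x1 ℤ.* x3) , ℤ.- (x1 ℤ.* x2) , x1 ℤ.* x2 ℤ.* x3 ⟩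

facetNormal-kernel : ∀ {l1 l2 l3} .{{_ : NonZero l1}} .{{_ : NonZero l2}} .{{_ : NonZero l3}} →
  Coprime l1 l2 → Coprime l1 l3 → Coprime l2 l3 →
  ∀ {d1 d2 d3 d4} → ℤ.∣ d1 ∣ ℕ.< l1 → ℤ.∣ d2 ∣ ℕ.< l2 → ℤ.∣ d3 ∣ ℕ.< l3 →
  facetNormal (+ l1) (+ l2) (+ l3) · ⟨ d1 , d2 , d3 , d4 ⟩ ≡ + 0 → ⟨ d1 , d2 , d3 , d4 ⟩ ≡ zero4
facetNormal-kernel {l1} {l2} {l3} c12 c13 c23 {d1} {d2} {d3} {d4} ∣d1∣<l1 ∣d2∣<l2 ∣d3∣<l3 ν·d≡0 =
  Z4-ext d1≡0 d2≡0 d3≡0 d4≡0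
  where
  x1 = + l1
  x2 = + l2
  x3 = + l3
  isolate₁ : ∀ x1 x2 x3 d1 d2 d3 d4 → x2 ℤ.* (x3 ℤ.* d1) ≡
    x1 ℤ.* (x2 ℤ.* x3 ℤ.* d4 ℤ.- x3 ℤ.* d2 ℤ.- x2 ℤ.* d3) ℤ.-
    (ℤ.- (x2 ℤ.* x3) ℤ.* d1 ℤ.+ ℤ.- (x1 ℤ.* x3) ℤ.* d2 ℤ.+ ℤ.- (x1 ℤ.* x2) ℤ.* d3 ℤ.+ x1 ℤ.* x2 ℤ.* x3 ℤ.* d4)
  isolate₁ = ℤ-Solver.solve-∀
  isolate₂ : ∀ x1 x2 x3 d1 d2 d3 d4 → x1 ℤ.* (x3 ℤ.* d2) ≡
    x2 ℤ.* (x1 ℤ.* x3 ℤ.* d4 ℤ.- x3 ℤ.* d1 ℤ.- x1 ℤ.* d3) ℤ.-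
    (ℤ.- (x2 ℤ.* x3) ℤ.* d1 ℤ.+ ℤ.- (x1 ℤ.* x3) ℤ.* d2 ℤ.+ ℤ.- (x1 ℤ.* x2) ℤ.* d3 ℤ.+ x1 ℤ.* x2 ℤ.* x3 ℤ.* d4)
  isolate₂ = ℤ-Solver.solve-∀
  isolate₃ : ∀ x1 x2 x3 d1 d2 d3 d4 → x1 ℤ.* (x2 ℤ.* d3) ≡
    x3 ℤ.* (x1 ℤ.* x2 ℤ.* d4 ℤ.- x2 ℤ.* d1 ℤ.- x1 ℤ.* d2) ℤ.-
    (ℤ.- (x2 ℤ.* x3) ℤ.* d1 ℤ.+ ℤ.- (x1 ℤ.* x3) ℤ.* d2 ℤ.+ ℤ.- (x1 ℤ.* x2) ℤ.* d3 ℤ.+ x1 ℤ.* x2 ℤ.* x3 ℤ.* d4)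
  isolate₃ = ℤ-Solver.solve-∀
  isolate₄ : ∀ x1 x2 x3 d4 → x1 ℤ.* x2 ℤ.* x3 ℤ.* d4 ≡
    ℤ.- (x2 ℤ.* x3) ℤ.* + 0 ℤ.+ ℤ.- (x1 ℤ.* x3) ℤ.* + 0 ℤ.+ ℤ.- (x1 ℤ.* x2) ℤ.* + 0 ℤ.+ x1 ℤ.* x2 ℤ.* x3 ℤ.* d4
  isolate₄ = ℤ-Solver.solve-∀

  drop-zero : ∀ {a b c} → a ≡ b ℤ.- c → c ≡ + 0 → a ≡ b
  drop-zero {b = b} refl refl = ℤP.+-identityʳ b

  d1≡0 : d1 ≡ + 0
  d1≡0 = coprime-multiple-small c12 c13
    (drop-zero (isolate₁ x1 x2 x3 d1 d2 d3 d4) ν·d≡0) ∣d1∣<l1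
  d2≡0 : d2 ≡ + 0
  d2≡0 = coprime-multiple-small (Coprimality.sym c12) c23
    (drop-zero (isolate₂ x1 x2 x3 d1 d2 d3 d4) ν·d≡0) ∣d2∣<l2
  d3≡0 : d3 ≡ + 0
  d3≡0 = coprime-multiple-small (Coprimality.sym c13) (Coprimality.sym c23)
    (drop-zero (isolate₃ x1 x2 x3 d1 d2 d3 d4) ν·d≡0) ∣d3∣<l3
  d4≡0 : d4 ≡ + 0
  d4≡0 = ℤP.*-cancelˡ-≡ (+ (l1 ℕ.* l2 ℕ.* l3)) d4 (+ 0) {{ℕP.m*n≢0 (l1 ℕ.* l2) l3 {{ℕP.m*n≢0 l1 l2}}}} (begin
    + (l1 ℕ.* l2 ℕ.* l3) ℤ.* d4   ≡⟨ cong (ℤ._* d4) (pos-*³ l1 l2 l3) ⟩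
    x1 ℤ.* x2 ℤ.* x3 ℤ.* d4       ≡⟨ isolate₄ x1 x2 x3 d4 ⟩
    facetNormal x1 x2 x3 · ⟨ + 0 , + 0 , + 0 , d4 ⟩  ≡⟨ cong₂ (λ u v → facetNormal x1 x2 x3 · ⟨ u , v , + 0 , d4 ⟩) d1≡0 d2≡0 ⟨
    facetNormal x1 x2 x3 · ⟨ d1 , d2 , + 0 , d4 ⟩    ≡⟨ cong (λ u → facetNormal x1 x2 x3 · ⟨ d1 , d2 , u , d4 ⟩) d3≡0 ⟨
    facetNormal x1 x2 x3 · ⟨ d1 , d2 , d3 , d4 ⟩     ≡⟨ ν·d≡0 ⟩
    + 0                            ≡⟨ ℤP.*-zeroʳ (+ (l1 ℕ.* l2 ℕ.* l3)) ⟨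
    + (l1 ℕ.* l2 ℕ.* l3) ℤ.* + 0  ∎)
    where open ≡-Reasoning

module PairwiseCoprime (l1 l2 l3 : ℕ) .{{_ : NonZero l1}} .{{_ : NonZero l2}} .{{_ : NonZero l3}}
                       (c12 : Coprime l1 l2) (c13 : Coprime l1 l3) (c23 : Coprime l2 l3) where

  ν : Z4
  ν = facetNormal (+ l1) (+ l2) (+ l3)

  L≡l1l2l3 : L l1 l2 l3 ≡ l1 ℕ.* (l2 ℕ.* l3)
  L≡l1l2l3 = trans (cong (lcm l1) (lcm-coprime c23)) (lcm-coprime (coprime-* c12 c13))

  σ≡ν· : ∀ z → σ l1 l2 l3 z ≡ ν · z
  σ≡ν· ⟨ z1 , z2 , z3 , z4 ⟩ = begin
    σ l1 l2 l3 ⟨ z1 , z2 , z3 , z4 ⟩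
      ≡⟨ cong₂ (λ u v → u ℤ.* z4 ℤ.- v) (trans (cong +_ (trans L≡l1l2l3 (sym (ℕP.*-assoc l1 l2 l3)))) (pos-*³ l1 l2 l3))
           (cong₂ ℤ._+_ (cong₂ ℤ._+_ (cong (ℤ._* z1) (quotient l2 l3 l1 (trans L≡l1l2l3 (ℕP.*-comm l1 (l2 ℕ.* l3)))))
                                     (cong (ℤ._* z2) (quotient l1 l3 l2 (trans L≡l1l2l3 (swap l1 l2 l3)))))
                        (cong (ℤ._* z3) (quotient l1 l2 l3 (trans L≡l1l2l3 (sym (ℕP.*-assoc l1 l2 l3)))))) ⟩
    x1 ℤ.* x2 ℤ.* x3 ℤ.* z4 ℤ.- (x2 ℤ.* x3 ℤ.* z1 ℤ.+ x1 ℤ.* x3 ℤ.* z2 ℤ.+ x1 ℤ.* x2 ℤ.* z3)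
      ≡⟨ identity x1 x2 x3 z1 z2 z3 z4 ⟩
    ν · ⟨ z1 , z2 , z3 , z4 ⟩ ∎
    where
    open ≡-Reasoning
    x1 = + l1
    x2 = + l2
    x3 = + l3
    quotient : ∀ a b n .{{_ : NonZero n}} → L l1 l2 l3 ≡ a ℕ.* b ℕ.* n → + (L l1 l2 l3 ℕ./ n) ≡ + a ℤ.* + b
    quotient a b n L≡abn = trans (cong (λ m → + (m ℕ./ n)) L≡abn) (trans (cong +_ (m*n/n≡m (a ℕ.* b) n)) (ℤP.pos-* a b))
    identity : ∀ x1 x2 x3 z1 z2 z3 z4 →
      x1 ℤ.* x2 ℤ.* x3 ℤ.* z4 ℤ.- (x2 ℤ.* x3 ℤ.* z1 ℤ.+ x1 ℤ.* x3 ℤ.* z2 ℤ.+ x1 ℤ.* x2 ℤ.* z3) ≡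
      ℤ.- (x2 ℤ.* x3) ℤ.* z1 ℤ.+ ℤ.- (x1 ℤ.* x3) ℤ.* z2 ℤ.+ ℤ.- (x1 ℤ.* x2) ℤ.* z3 ℤ.+ x1 ℤ.* x2 ℤ.* x3 ℤ.* z4
    identity = ℤ-Solver.solve-∀
    swap : ∀ a b c → a ℕ.* (b ℕ.* c) ≡ a ℕ.* c ℕ.* b
    swap = ℕ-Solver.solve-∀

  record Reduced (z : Z4) : Set where
    constructor reduced
    field
      {r1 r2 r3} : ℕ
      c1≡r1 : c1 z ≡ + r1
      c2≡r2 : c2 z ≡ + r2
      c3≡r3 : c3 z ≡ + r3
      r1<l1 : r1 ℕ.< l1
      r2<l2 : r2 ℕ.< l2
      r3<l3 : r3 ℕ.< l3

  reduced-unique : ∀ {z w} → Reduced z → Reduced w → ν · z ≡ ν · w → z ≡ w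
  reduced-unique {⟨ _ , _ , _ , z4 ⟩} {⟨ _ , _ , _ , w4 ⟩}
                 (reduced {a1} {a2} {a3} refl refl refl a1<l1 a2<l2 a3<l3)
                 (reduced {b1} {b2} {b3} refl refl refl b1<l1 b2<l2 b3<l3) ν·z≡ν·w
    = Z4-ext (ℤP.i-j≡0⇒i≡j (+ a1) (+ b1) (cong c1 d≡0)) (ℤP.i-j≡0⇒i≡j (+ a2) (+ b2) (cong c2 d≡0))
             (ℤP.i-j≡0⇒i≡j (+ a3) (+ b3) (cong c3 d≡0)) (ℤP.i-j≡0⇒i≡j z4 w4 (cong c4 d≡0))
    where
    ν·d≡0 : ν · ⟨ + a1 ℤ.- + b1 , + a2 ℤ.- + b2 , + a3 ℤ.- + b3 , z4 ℤ.- w4 ⟩ ≡ + 0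
    ν·d≡0 = trans (linear (+ l1) (+ l2) (+ l3) (+ a1) (+ a2) (+ a3) z4 (+ b1) (+ b2) (+ b3) w4)
                  (ℤP.i≡j⇒i-j≡0 ν·z≡ν·w)
      where
      linear : ∀ x1 x2 x3 z1 z2 z3 z4 w1 w2 w3 w4 →
        ℤ.- (x2 ℤ.* x3) ℤ.* (z1 ℤ.- w1) ℤ.+ ℤ.- (x1 ℤ.* x3) ℤ.* (z2 ℤ.- w2) ℤ.+ ℤ.- (x1 ℤ.* x2) ℤ.* (z3 ℤ.- w3) ℤ.+ x1 ℤ.* x2 ℤ.* x3 ℤ.* (z4 ℤ.- w4) ≡
        (ℤ.- (x2 ℤ.* x3) ℤ.* z1 ℤ.+ ℤ.- (x1 ℤ.* x3) ℤ.* z2 ℤ.+ ℤ.- (x1 ℤ.* x2) ℤ.* z3 ℤ.+ x1 ℤ.* x2 ℤ.* x3 ℤ.* z4) ℤ.-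
        (ℤ.- (x2 ℤ.* x3) ℤ.* w1 ℤ.+ ℤ.- (x1 ℤ.* x3) ℤ.* w2 ℤ.+ ℤ.- (x1 ℤ.* x2) ℤ.* w3 ℤ.+ x1 ℤ.* x2 ℤ.* x3 ℤ.* w4)
      linear = ℤ-Solver.solve-∀
    d≡0 = facetNormal-kernel c12 c13 c23 (∣m-n∣<l a1<l1 b1<l1) (∣m-n∣<l a2<l2 b2<l2) (∣m-n∣<l a3<l3 b3<l3) ν·d≡0

  generator-intro′ : ∀ {z} → + 0 ℤ.≤ c1 z → + 0 ℤ.≤ c2 z → + 0 ℤ.≤ c3 z → c4 z ≡ + 1 →
                     + 0 ℤ.≤ ν · z → Generator l1 l2 l3 z
  generator-intro′ {z} 0≤z1 0≤z2 0≤z3 z4≡1 0≤ν·z =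
    generator-intro l1 l2 l3 0≤z1 0≤z2 0≤z3 z4≡1 (subst (+ 0 ℤ.≤_) (sym (σ≡ν· z)) 0≤ν·z)

  generator⇒ν·-nonNeg : ∀ {z} → Generator l1 l2 l3 z → + 0 ℤ.≤ ν · z
  generator⇒ν·-nonNeg {z} G = subst (+ 0 ℤ.≤_) (σ≡ν· z) (generator⇒σ-nonNeg l1 l2 l3 G)

  V₁ V₂ V₃ : Z4
  V₁ = ⟨ + l1 , + 0 , + 0 , + 1 ⟩
  V₂ = ⟨ + 0 , + l2 , + 0 , + 1 ⟩
  V₃ = ⟨ + 0 , + 0 , + l3 , + 1 ⟩

  private
    vertex : ∀ {z} → ν · z ≡ + 0 → c4 z ≡ + 1 → + 0 ℤ.≤ c1 z → + 0 ℤ.≤ c2 z → + 0 ℤ.≤ c3 z → Generator l1 l2 l3 z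
    vertex ν·z≡0 z4≡1 0≤z1 0≤z2 0≤z3 = generator-intro′ 0≤z1 0≤z2 0≤z3 z4≡1 (ℤP.≤-reflexive (sym ν·z≡0))

  ν·V₁≡0 : ν · V₁ ≡ + 0
  ν·V₁≡0 = identity (+ l1) (+ l2) (+ l3)
    where
    identity : ∀ x1 x2 x3 → ℤ.- (x2 ℤ.* x3) ℤ.* x1 ℤ.+ ℤ.- (x1 ℤ.* x3) ℤ.* + 0 ℤ.+ ℤ.- (x1 ℤ.* x2) ℤ.* + 0 ℤ.+ x1 ℤ.* x2 ℤ.* x3 ℤ.* + 1 ≡ + 0
    identity = ℤ-Solver.solve-∀

  ν·V₂≡0 : ν · V₂ ≡ + 0
  ν·V₂≡0 = identity (+ l1) (+ l2) (+ l3)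
    where
    identity : ∀ x1 x2 x3 → ℤ.- (x2 ℤ.* x3) ℤ.* + 0 ℤ.+ ℤ.- (x1 ℤ.* x3) ℤ.* x2 ℤ.+ ℤ.- (x1 ℤ.* x2) ℤ.* + 0 ℤ.+ x1 ℤ.* x2 ℤ.* x3 ℤ.* + 1 ≡ + 0
    identity = ℤ-Solver.solve-∀

  ν·V₃≡0 : ν · V₃ ≡ + 0
  ν·V₃≡0 = identity (+ l1) (+ l2) (+ l3)
    where
    identity : ∀ x1 x2 x3 → ℤ.- (x2 ℤ.* x3) ℤ.* + 0 ℤ.+ ℤ.- (x1 ℤ.* x3) ℤ.* + 0 ℤ.+ ℤ.- (x1 ℤ.* x2) ℤ.* x3 ℤ.+ x1 ℤ.* x2 ℤ.* x3 ℤ.* + 1 ≡ + 0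
    identity = ℤ-Solver.solve-∀

  ν·e₄≡l1l2l3 : ν · e₄ ≡ + (l1 ℕ.* l2 ℕ.* l3)
  ν·e₄≡l1l2l3 = trans (identity (+ l1) (+ l2) (+ l3)) (sym (pos-*³ l1 l2 l3))
    where
    identity : ∀ x1 x2 x3 → ℤ.- (x2 ℤ.* x3) ℤ.* + 0 ℤ.+ ℤ.- (x1 ℤ.* x3) ℤ.* + 0 ℤ.+ ℤ.- (x1 ℤ.* x2) ℤ.* + 0 ℤ.+ x1 ℤ.* x2 ℤ.* x3 ℤ.* + 1 ≡ x1 ℤ.* x2 ℤ.* x3
    identity = ℤ-Solver.solve-∀

  generator-V₁ : Generator l1 l2 l3 V₁
  generator-V₁ = vertex ν·V₁≡0 refl (0≤+ l1) (0≤+ 0) (0≤+ 0)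

  generator-V₂ : Generator l1 l2 l3 V₂
  generator-V₂ = vertex ν·V₂≡0 refl (0≤+ 0) (0≤+ l2) (0≤+ 0)

  generator-V₃ : Generator l1 l2 l3 V₃
  generator-V₃ = vertex ν·V₃≡0 refl (0≤+ 0) (0≤+ 0) (0≤+ l3)

  generator-e₄ : Generator l1 l2 l3 e₄
  generator-e₄ = generator-intro′ (0≤+ 0) (0≤+ 0) (0≤+ 0) refl (subst (+ 0 ℤ.≤_) (sym ν·e₄≡l1l2l3) (0≤+ _))

  vertexCombination : ℕ → ℕ → ℕ → ℕ → Z4
  vertexCombination n1 n2 n3 n0 = (n1 ⊙ V₁) ⊕ ((n2 ⊙ V₂) ⊕ ((n3 ⊙ V₃) ⊕ (n0 ⊙ e₄)))

  InQ-vertexCombination : ∀ n1 n2 n3 n0 → InQ l1 l2 l3 (vertexCombination n1 n2 n3 n0)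
  InQ-vertexCombination n1 n2 n3 n0 =
    InQ-⊕ l1 l2 l3 (InQ-⊙ l1 l2 l3 n1 generator-V₁) (InQ-⊕ l1 l2 l3 (InQ-⊙ l1 l2 l3 n2 generator-V₂)
      (InQ-⊕ l1 l2 l3 (InQ-⊙ l1 l2 l3 n3 generator-V₃) (InQ-⊙ l1 l2 l3 n0 generator-e₄)))

  vertexCombination-coordinates : ∀ n1 n2 n3 n0 → vertexCombination n1 n2 n3 n0 ≡
    ⟨ + n1 ℤ.* + l1 , + n2 ℤ.* + l2 , + n3 ℤ.* + l3 , + n1 ℤ.+ + n2 ℤ.+ + n3 ℤ.+ + n0 ⟩
  vertexCombination-coordinates n1 n2 n3 n0 =
    trans (cong₂ _⊕_ (⊙-coordinates n1 V₁) (cong₂ _⊕_ (⊙-coordinates n2 V₂) (cong₂ _⊕_ (⊙-coordinates n3 V₃) (⊙-coordinates n0 e₄))))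
          (Z4-ext (first (+ n1) (+ n2) (+ n3) (+ n0) (+ l1)) (second (+ n1) (+ n2) (+ n3) (+ n0) (+ l2))
                  (third (+ n1) (+ n2) (+ n3) (+ n0) (+ l3)) (fourth (+ n1) (+ n2) (+ n3) (+ n0)))
    where
    first : ∀ a b c d x → a ℤ.* x ℤ.+ (b ℤ.* + 0 ℤ.+ (c ℤ.* + 0 ℤ.+ d ℤ.* + 0)) ≡ a ℤ.* x
    first = ℤ-Solver.solve-∀
    second : ∀ a b c d x → a ℤ.* + 0 ℤ.+ (b ℤ.* x ℤ.+ (c ℤ.* + 0 ℤ.+ d ℤ.* + 0)) ≡ b ℤ.* x
    second = ℤ-Solver.solve-∀
    third : ∀ a b c d x → a ℤ.* + 0 ℤ.+ (b ℤ.* + 0 ℤ.+ (c ℤ.* x ℤ.+ d ℤ.* + 0)) ≡ c ℤ.* x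
    third = ℤ-Solver.solve-∀
    fourth : ∀ a b c d → a ℤ.* + 1 ℤ.+ (b ℤ.* + 1 ℤ.+ (c ℤ.* + 1 ℤ.+ d ℤ.* + 1)) ≡ a ℤ.+ b ℤ.+ c ℤ.+ d
    fourth = ℤ-Solver.solve-∀

  ν·vertexCombination : ∀ n1 n2 n3 n0 → ν · vertexCombination n1 n2 n3 n0 ≡ + n0 ℤ.* + (l1 ℕ.* l2 ℕ.* l3)
  ν·vertexCombination n1 n2 n3 n0 = begin
    ν · vertexCombination n1 n2 n3 n0
      ≡⟨ ·-distribˡ-⊕ ν _ _ ⟩
    ν · (n1 ⊙ V₁) ℤ.+ ν · ((n2 ⊙ V₂) ⊕ ((n3 ⊙ V₃) ⊕ (n0 ⊙ e₄)))
      ≡⟨ cong (ℤ._+_ (ν · (n1 ⊙ V₁))) (trans (·-distribˡ-⊕ ν _ _) (cong (ℤ._+_ (ν · (n2 ⊙ V₂))) (·-distribˡ-⊕ ν _ _))) ⟩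
    ν · (n1 ⊙ V₁) ℤ.+ (ν · (n2 ⊙ V₂) ℤ.+ (ν · (n3 ⊙ V₃) ℤ.+ ν · (n0 ⊙ e₄)))
      ≡⟨ cong₂ ℤ._+_ (·-⊙ ν n1 V₁) (cong₂ ℤ._+_ (·-⊙ ν n2 V₂) (cong₂ ℤ._+_ (·-⊙ ν n3 V₃) (·-⊙ ν n0 e₄))) ⟩
    + n1 ℤ.* ν · V₁ ℤ.+ (+ n2 ℤ.* ν · V₂ ℤ.+ (+ n3 ℤ.* ν · V₃ ℤ.+ + n0 ℤ.* ν · e₄))
      ≡⟨ cong₂ (λ u v → + n1 ℤ.* u ℤ.+ (+ n2 ℤ.* v ℤ.+ (+ n3 ℤ.* ν · V₃ ℤ.+ + n0 ℤ.* ν · e₄))) ν·V₁≡0 ν·V₂≡0 ⟩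
    + n1 ℤ.* + 0 ℤ.+ (+ n2 ℤ.* + 0 ℤ.+ (+ n3 ℤ.* ν · V₃ ℤ.+ + n0 ℤ.* ν · e₄))
      ≡⟨ cong₂ (λ u v → + n1 ℤ.* + 0 ℤ.+ (+ n2 ℤ.* + 0 ℤ.+ (+ n3 ℤ.* u ℤ.+ + n0 ℤ.* v))) ν·V₃≡0 ν·e₄≡l1l2l3 ⟩
    + n1 ℤ.* + 0 ℤ.+ (+ n2 ℤ.* + 0 ℤ.+ (+ n3 ℤ.* + 0 ℤ.+ + n0 ℤ.* + (l1 ℕ.* l2 ℕ.* l3)))
      ≡⟨ identity (+ n1) (+ n2) (+ n3) (+ n0) (+ (l1 ℕ.* l2 ℕ.* l3)) ⟩
    + n0 ℤ.* + (l1 ℕ.* l2 ℕ.* l3) ∎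
    where
    open ≡-Reasoning
    identity : ∀ a b c d x → a ℤ.* + 0 ℤ.+ (b ℤ.* + 0 ℤ.+ (c ℤ.* + 0 ℤ.+ d ℤ.* x)) ≡ d ℤ.* x
    identity = ℤ-Solver.solve-∀

  reduce : ∀ {z n1 n2 n3} → c1 z ≡ + n1 → c2 z ≡ + n2 → c3 z ≡ + n3 →
           Σ Z4 λ r → Reduced r × (ν · r ≡ ν · z) × (InQ l1 l2 l3 r → InQ l1 l2 l3 z)
  reduce {⟨ _ , _ , _ , z4 ⟩} {n1} {n2} {n3} refl refl refl =
    r , reduced refl refl refl (m%n<n n1 l1) (m%n<n n2 l2) (m%n<n n3 l3) , ν·r≡ν·z ,
    λ qr → subst (InQ l1 l2 l3) (sym z≡v⊕r) (InQ-⊕ l1 l2 l3 (InQ-vertexCombination q1 q2 q3 0) qr)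
    where
    q1 = n1 ℕ./ l1
    q2 = n2 ℕ./ l2
    q3 = n3 ℕ./ l3
    r : Z4
    r = ⟨ + (n1 ℕ.% l1) , + (n2 ℕ.% l2) , + (n3 ℕ.% l3) , z4 ℤ.- (+ q1 ℤ.+ + q2 ℤ.+ + q3) ⟩
    division : ∀ m n .{{_ : NonZero n}} → + (m ℕ./ n) ℤ.* + n ℤ.+ + (m ℕ.% n) ≡ + m
    division m n = begin
      + (m ℕ./ n) ℤ.* + n ℤ.+ + (m ℕ.% n)  ≡⟨ cong (ℤ._+ + (m ℕ.% n)) (ℤP.pos-* (m ℕ./ n) n) ⟨
      + (m ℕ./ n ℕ.* n) ℤ.+ + (m ℕ.% n)    ≡⟨ ℤP.pos-+ (m ℕ./ n ℕ.* n) (m ℕ.% n) ⟨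
      + (m ℕ./ n ℕ.* n ℕ.+ m ℕ.% n)        ≡⟨ cong +_ (ℕP.+-comm (m ℕ./ n ℕ.* n) (m ℕ.% n)) ⟩
      + (m ℕ.% n ℕ.+ m ℕ./ n ℕ.* n)        ≡⟨ cong +_ (m≡m%n+[m/n]*n m n) ⟨
      + m                                  ∎
      where open ≡-Reasoning
    level : ∀ a b c z4 → a ℤ.+ b ℤ.+ c ℤ.+ + 0 ℤ.+ (z4 ℤ.- (a ℤ.+ b ℤ.+ c)) ≡ z4
    level = ℤ-Solver.solve-∀
    z≡v⊕r : ⟨ + n1 , + n2 , + n3 , z4 ⟩ ≡ vertexCombination q1 q2 q3 0 ⊕ r
    z≡v⊕r = sym (trans (cong (_⊕ r) (vertexCombination-coordinates q1 q2 q3 0))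
                       (Z4-ext (division n1 l1) (division n2 l2) (division n3 l3) (level (+ q1) (+ q2) (+ q3) z4)))
    ν·r≡ν·z : ν · r ≡ ν · ⟨ + n1 , + n2 , + n3 , z4 ⟩
    ν·r≡ν·z = sym (begin
      ν · ⟨ + n1 , + n2 , + n3 , z4 ⟩                   ≡⟨ cong (ν ·_) z≡v⊕r ⟩
      ν · (vertexCombination q1 q2 q3 0 ⊕ r)             ≡⟨ ·-distribˡ-⊕ ν _ r ⟩
      ν · vertexCombination q1 q2 q3 0 ℤ.+ ν · r         ≡⟨ cong (ℤ._+ ν · r) (ν·vertexCombination q1 q2 q3 0) ⟩
      + 0 ℤ.* + (l1 ℕ.* l2 ℕ.* l3) ℤ.+ ν · r             ≡⟨ ℤP.+-identityˡ (ν · r) ⟩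
      ν · r                                              ∎)
      where open ≡-Reasoning

  l1l2l3⊙z≡vertexCombination : ∀ {n1 n2 n3 z4 s} → ν · ⟨ + n1 , + n2 , + n3 , z4 ⟩ ≡ + s →
    (l1 ℕ.* l2 ℕ.* l3) ⊙ ⟨ + n1 , + n2 , + n3 , z4 ⟩ ≡ vertexCombination (l2 ℕ.* l3 ℕ.* n1) (l1 ℕ.* l3 ℕ.* n2) (l1 ℕ.* l2 ℕ.* n3) s
  l1l2l3⊙z≡vertexCombination {n1} {n2} {n3} {z4} {s} ν·z≡s =
    trans (⊙-coordinates M ⟨ + n1 , + n2 , + n3 , z4 ⟩)
          (sym (trans (vertexCombination-coordinates (l2 ℕ.* l3 ℕ.* n1) (l1 ℕ.* l3 ℕ.* n2) (l1 ℕ.* l2 ℕ.* n3) s) (Z4-ext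
      (coordinate (l2 ℕ.* l3 ℕ.* n1) l1 n1 (first l1 l2 l3 n1)) (coordinate (l1 ℕ.* l3 ℕ.* n2) l2 n2 (second l1 l2 l3 n2))
      (coordinate (l1 ℕ.* l2 ℕ.* n3) l3 n3 (third l1 l2 l3 n3))
      (begin
        + (l2 ℕ.* l3 ℕ.* n1) ℤ.+ + (l1 ℕ.* l3 ℕ.* n2) ℤ.+ + (l1 ℕ.* l2 ℕ.* n3) ℤ.+ + s
          ≡⟨ cong₂ ℤ._+_ (cong₂ ℤ._+_ (cong₂ ℤ._+_ (pos-*³ l2 l3 n1) (pos-*³ l1 l3 n2)) (pos-*³ l1 l2 n3)) (sym ν·z≡s) ⟩
        x2 ℤ.* x3 ℤ.* + n1 ℤ.+ x1 ℤ.* x3 ℤ.* + n2 ℤ.+ x1 ℤ.* x2 ℤ.* + n3 ℤ.+ ν · ⟨ + n1 , + n2 , + n3 , z4 ⟩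
          ≡⟨ level x1 x2 x3 (+ n1) (+ n2) (+ n3) z4 ⟨
        x1 ℤ.* x2 ℤ.* x3 ℤ.* z4
          ≡⟨ cong (ℤ._* z4) (pos-*³ l1 l2 l3) ⟨
        + M ℤ.* z4 ∎))))
    where
    open ≡-Reasoning
    M = l1 ℕ.* l2 ℕ.* l3
    x1 = + l1
    x2 = + l2
    x3 = + l3
    coordinate : ∀ a l n → M ℕ.* n ≡ a ℕ.* l → + a ℤ.* + l ≡ + M ℤ.* + n
    coordinate a l n Mn≡al = trans (sym (ℤP.pos-* a l)) (trans (cong +_ (sym Mn≡al)) (ℤP.pos-* M n))
    first : ∀ a b c n → a ℕ.* b ℕ.* c ℕ.* n ≡ b ℕ.* c ℕ.* n ℕ.* a
    first = ℕ-Solver.solve-∀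
    second : ∀ a b c n → a ℕ.* b ℕ.* c ℕ.* n ≡ a ℕ.* c ℕ.* n ℕ.* b
    second = ℕ-Solver.solve-∀
    third : ∀ a b c n → a ℕ.* b ℕ.* c ℕ.* n ≡ a ℕ.* b ℕ.* n ℕ.* c
    third = ℕ-Solver.solve-∀
    level : ∀ x1 x2 x3 n1 n2 n3 z4 → x1 ℤ.* x2 ℤ.* x3 ℤ.* z4 ≡
      x2 ℤ.* x3 ℤ.* n1 ℤ.+ x1 ℤ.* x3 ℤ.* n2 ℤ.+ x1 ℤ.* x2 ℤ.* n3 ℤ.+
      (ℤ.- (x2 ℤ.* x3) ℤ.* n1 ℤ.+ ℤ.- (x1 ℤ.* x3) ℤ.* n2 ℤ.+ ℤ.- (x1 ℤ.* x2) ℤ.* n3 ℤ.+ x1 ℤ.* x2 ℤ.* x3 ℤ.* z4)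
    level = ℤ-Solver.solve-∀

  InCone-intro : ∀ {z} → + 0 ℤ.≤ c1 z → + 0 ℤ.≤ c2 z → + 0 ℤ.≤ c3 z → + 0 ℤ.≤ ν · z → InCone l1 l2 l3 z
  InCone-intro {z} (ℤ.+≤+ {n = n1} _) (ℤ.+≤+ {n = n2} _) (ℤ.+≤+ {n = n3} _) 0≤ν·z =
    InCone-of-multiple l1 l2 l3 (l1 ℕ.* l2 ℕ.* l3) {{ℕP.m*n≢0 (l1 ℕ.* l2) l3 {{ℕP.m*n≢0 l1 l2}}}}
      (subst (InQ l1 l2 l3) (sym (l1l2l3⊙z≡vertexCombination (sym (ℤP.0≤i⇒+∣i∣≡i 0≤ν·z))))
        (InQ-vertexCombination (l2 ℕ.* l3 ℕ.* n1) (l1 ℕ.* l3 ℕ.* n2) (l1 ℕ.* l2 ℕ.* n3) ℤ.∣ ν · z ∣))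

Even Odd : ℕ → Set
Even n = Σ ℕ λ k → n ≡ 2 ℕ.* k
Odd  n = Σ ℕ λ k → n ≡ suc (2 ℕ.* k)

even-or-odd : ∀ n → Even n ⊎ Odd n
even-or-odd zero = inj₁ (0 , refl)
even-or-odd (suc n) with even-or-odd n
... | inj₁ (k , refl) = inj₂ (k , refl)
... | inj₂ (k , refl) = inj₁ (suc k , cong suc (sym (ℕP.+-suc k (k ℕ.+ 0))))

¬odd-zero : ¬ Odd 0
¬odd-zero (_ , ())

coprime-even⇒odd : ∀ {m n} → Coprime m n → Even m → Odd n
coprime-even⇒odd {n = n} m⊥n (k , refl) with even-or-odd n
... | inj₂ odd = odd
... | inj₁ (k′ , refl) with () ← m⊥n (divides k (ℕP.*-comm 2 k) , divides k′ (ℕP.*-comm 2 k′))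

odd-not-sum-of-two-odd : ∀ {N s₁ s₂} → Odd N → s₁ ℕ.+ s₂ ≡ N →
                         (s₁ ℕ.< N → Odd s₁) → (s₂ ℕ.< N → Odd s₂) → ⊥
odd-not-sum-of-two-odd {s₁ = zero} (_ , refl) _ odd₁ _ = ¬odd-zero (odd₁ ℕ.z<s)
odd-not-sum-of-two-odd {s₁ = suc a} {zero} (_ , refl) _ _ odd₂ = ¬odd-zero (odd₂ ℕ.z<s)
odd-not-sum-of-two-odd {s₁ = suc a} {suc b} (m , refl) s₁+s₂≡N odd₁ odd₂
  with (k₁ , refl) ← odd₁ (subst (suc a ℕ.<_) s₁+s₂≡N (ℕP.m<m+n (suc a) ℕ.z<s))
     | (k₂ , refl) ← odd₂ (subst (suc b ℕ.<_) s₁+s₂≡N (ℕP.m<n+m (suc b) ℕ.z<s)) =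
  ℕP.even≢odd (suc (k₁ ℕ.+ k₂)) m (trans (sym (identity k₁ k₂)) s₁+s₂≡N)
  where
  identity : ∀ k₁ k₂ → suc (2 ℕ.* k₁) ℕ.+ suc (2 ℕ.* k₂) ≡ 2 ℕ.* suc (k₁ ℕ.+ k₂)
  identity = ℕ-Solver.solve-∀

odd+2 : ∀ a → suc (2 ℕ.* a) ℕ.+ 2 ≡ suc (2 ℕ.* suc a)
odd+2 = ℕ-Solver.solve-∀

odd<⇒≤ : ∀ {t a} → suc (2 ℕ.* t) ℕ.< suc (2 ℕ.* a) ℕ.+ 2 → t ℕ.≤ a
odd<⇒≤ {t} {a} bound = ℕP.≤-pred (ℕP.*-cancelˡ-< 2 t (suc a) (ℕP.≤-pred (subst (suc (2 ℕ.* t) ℕ.<_) (odd+2 a) bound)))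

even<⇒≤ : ∀ {t a} → 2 ℕ.* suc t ℕ.< suc (2 ℕ.* a) ℕ.+ 2 → t ℕ.≤ a
even<⇒≤ {t} {a} bound = ℕP.≤-pred (ℕP.*-cancelˡ-≤ 2 (ℕP.≤-pred (subst (2 ℕ.* suc t ℕ.<_) (odd+2 a) bound)))

pos-even : ∀ k → + (2 ℕ.* k) ≡ + 2 ℤ.* + k
pos-even k = ℤP.pos-* 2 k

pos-odd : ∀ k → + suc (2 ℕ.* k) ≡ + 1 ℤ.+ + 2 ℤ.* + k
pos-odd k = trans (ℤP.pos-+ 1 (2 ℕ.* k)) (cong (ℤ._+_ (+ 1)) (ℤP.pos-* 2 k))

1+2i≢2 : ∀ i → + 1 ℤ.+ + 2 ℤ.* i ≢ + 2
1+2i≢2 (+ 0) ()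
1+2i≢2 (+ 1) ()
1+2i≢2 (+ suc (suc n)) ()
1+2i≢2 -[1+ 0 ] ()
1+2i≢2 -[1+ suc n ] ()

-- Good triples

goodForm : ℤ → ℤ → ℤ → ℤ
goodForm x1 x2 x3 = x2 ℤ.* x3 ℤ.- + 2 ℤ.* x1 ℤ.* x3 ℤ.+ x1 ℤ.* x2

goodForm-even-odd-odd≢2 : ∀ {x1 x2 x3} k p q → x1 ≡ + 2 ℤ.* k → x2 ≡ + 1 ℤ.+ + 2 ℤ.* p → x3 ≡ + 1 ℤ.+ + 2 ℤ.* q →
                          goodForm x1 x2 x3 ≢ + 2
goodForm-even-odd-odd≢2 k p q refl refl refl = 1+2i≢2 (half k p q) ∘ trans (sym (identity k p q))
  where
  half : ℤ → ℤ → ℤ → ℤ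
  half k p q = p ℤ.+ q ℤ.+ + 2 ℤ.* p ℤ.* q ℤ.- + 2 ℤ.* k ℤ.* (+ 1 ℤ.+ + 2 ℤ.* q) ℤ.+ k ℤ.* (+ 1 ℤ.+ + 2 ℤ.* p)
  identity : ∀ k p q → let x1 = + 2 ℤ.* k ; x2 = + 1 ℤ.+ + 2 ℤ.* p ; x3 = + 1 ℤ.+ + 2 ℤ.* q in
    x2 ℤ.* x3 ℤ.- + 2 ℤ.* x1 ℤ.* x3 ℤ.+ x1 ℤ.* x2 ≡
    + 1 ℤ.+ + 2 ℤ.* (p ℤ.+ q ℤ.+ + 2 ℤ.* p ℤ.* q ℤ.- + 2 ℤ.* k ℤ.* x3 ℤ.+ k ℤ.* x2)
  identity = ℤ-Solver.solve-∀

goodForm-odd-odd-even≢2 : ∀ {x1 x2 x3} a b c → x1 ≡ + 1 ℤ.+ + 2 ℤ.* a → x2 ≡ + 1 ℤ.+ + 2 ℤ.* b → x3 ≡ + 2 ℤ.* c →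
                          goodForm x1 x2 x3 ≢ + 2
goodForm-odd-odd-even≢2 a b c refl refl refl = 1+2i≢2 (half a b c) ∘ trans (sym (identity a b c))
  where
  half : ℤ → ℤ → ℤ → ℤ
  half a b c = (+ 1 ℤ.+ + 2 ℤ.* b) ℤ.* c ℤ.- + 2 ℤ.* (+ 1 ℤ.+ + 2 ℤ.* a) ℤ.* c ℤ.+ a ℤ.+ b ℤ.+ + 2 ℤ.* a ℤ.* b
  identity : ∀ a b c → let x1 = + 1 ℤ.+ + 2 ℤ.* a ; x2 = + 1 ℤ.+ + 2 ℤ.* b ; x3 = + 2 ℤ.* c in
    x2 ℤ.* x3 ℤ.- + 2 ℤ.* x1 ℤ.* x3 ℤ.+ x1 ℤ.* x2 ≡
    + 1 ℤ.+ + 2 ℤ.* (x2 ℤ.* c ℤ.- + 2 ℤ.* x1 ℤ.* c ℤ.+ a ℤ.+ b ℤ.+ + 2 ℤ.* a ℤ.* b)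
  identity = ℤ-Solver.solve-∀

twice-height-oddPoint : ∀ {x1 x3} x2 t e f → x1 ≡ + 1 ℤ.+ + 2 ℤ.* (t ℤ.+ e) → x3 ≡ + 1 ℤ.+ + 2 ℤ.* (t ℤ.+ e ℤ.+ f) →
  + 2 ℤ.* (facetNormal x1 x2 x3 · ⟨ e , + 1 ℤ.+ + 2 ℤ.* t , e ℤ.+ f , + 1 ⟩) ≡ (+ 1 ℤ.+ + 2 ℤ.* t) ℤ.* goodForm x1 x2 x3
twice-height-oddPoint x2 t e f refl refl = identity t e f x2
  where
  identity : ∀ t e f x2 → let x1 = + 1 ℤ.+ + 2 ℤ.* (t ℤ.+ e) ; x3 = + 1 ℤ.+ + 2 ℤ.* (t ℤ.+ e ℤ.+ f) in
    + 2 ℤ.* (ℤ.- (x2 ℤ.* x3) ℤ.* e ℤ.+ ℤ.- (x1 ℤ.* x3) ℤ.* (+ 1 ℤ.+ + 2 ℤ.* t) ℤ.+ ℤ.- (x1 ℤ.* x2) ℤ.* (e ℤ.+ f) ℤ.+ x1 ℤ.* x2 ℤ.* x3 ℤ.* + 1)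
    ≡ (+ 1 ℤ.+ + 2 ℤ.* t) ℤ.* (x2 ℤ.* x3 ℤ.- + 2 ℤ.* x1 ℤ.* x3 ℤ.+ x1 ℤ.* x2)
  identity = ℤ-Solver.solve-∀

twice-height-hole : ∀ {x1 x3} x2 a d → x1 ≡ + 1 ℤ.+ + 2 ℤ.* a → x3 ≡ + 1 ℤ.+ + 2 ℤ.* (a ℤ.+ (+ 1 ℤ.+ d)) →
  + 2 ℤ.* (facetNormal x1 x2 x3 · ⟨ + 2 ℤ.* a , x1 ℤ.+ + 2 , d , + 2 ⟩) ≡ (x1 ℤ.+ + 2) ℤ.* goodForm x1 x2 x3
twice-height-hole x2 a d refl refl = identity a d x2
  where
  identity : ∀ a d x2 → let x1 = + 1 ℤ.+ + 2 ℤ.* a ; x3 = + 1 ℤ.+ + 2 ℤ.* (a ℤ.+ (+ 1 ℤ.+ d)) in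
    + 2 ℤ.* (ℤ.- (x2 ℤ.* x3) ℤ.* (+ 2 ℤ.* a) ℤ.+ ℤ.- (x1 ℤ.* x3) ℤ.* (x1 ℤ.+ + 2) ℤ.+ ℤ.- (x1 ℤ.* x2) ℤ.* d ℤ.+ x1 ℤ.* x2 ℤ.* x3 ℤ.* + 2)
    ≡ (x1 ℤ.+ + 2) ℤ.* (x2 ℤ.* x3 ℤ.- + 2 ℤ.* x1 ℤ.* x3 ℤ.+ x1 ℤ.* x2)
  identity = ℤ-Solver.solve-∀

module GoodTripleTheory (l1 l2 l3 : ℕ) .{{_ : NonZero l1}} .{{_ : NonZero l2}} .{{_ : NonZero l3}}
                        (good : GoodTriple l1 l2 l3) where
  open GoodTriple good
  open PairwiseCoprime l1 l2 l3 cop12 cop13 cop23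

  l1-odd : Odd l1
  l1-odd with even-or-odd l1
  ... | inj₂ odd = odd
  ... | inj₁ (k , l1≡2k) with (p , l2≡) ← coprime-even⇒odd cop12 (k , l1≡2k) | (q , l3≡) ← coprime-even⇒odd cop13 (k , l1≡2k) =
    ⊥-elim (goodForm-even-odd-odd≢2 (+ k) (+ p) (+ q) (trans (cong +_ l1≡2k) (pos-even k))
              (trans (cong +_ l2≡) (pos-odd p)) (trans (cong +_ l3≡) (pos-odd q)) eqn)

  l3-odd : Odd l3
  l3-odd with even-or-odd l3
  ... | inj₂ odd = odd
  ... | inj₁ (c , l3≡2c) with (b , l2≡) ← coprime-even⇒odd (Coprimality.sym cop23) (c , l3≡2c) | (a , l1≡) ← l1-odd =
    ⊥-elim (goodForm-odd-odd-even≢2 (+ a) (+ b) (+ c) (trans (cong +_ l1≡) (pos-odd a))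
              (trans (cong +_ l2≡) (pos-odd b)) (trans (cong +_ l3≡2c) (pos-even c)) eqn)

  α : ℕ
  α = proj₁ l1-odd

  l1≡1+2α : l1 ≡ suc (2 ℕ.* α)
  l1≡1+2α = proj₂ l1-odd

  private
    α<γ : α ℕ.< proj₁ l3-odd
    α<γ = ℕP.*-cancelˡ-< 2 α (proj₁ l3-odd) (ℕP.≤-pred (subst₂ ℕ._<_ l1≡1+2α (proj₂ l3-odd) l1<l3))
      where
      l1<l3 : l1 ℕ.< l3
      l1<l3 = ℕP.<-≤-trans (ℕP.≤-<-trans (ℕP.m≤m+n l1 2) gap) ord23

  δ : ℕ
  δ = proj₁ (ℕP.m≤n⇒∃[o]m+o≡n α<γ)

  l3≡1+2[α+1+δ] : l3 ≡ suc (2 ℕ.* (α ℕ.+ suc δ))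
  l3≡1+2[α+1+δ] = trans (proj₂ l3-odd)
    (cong (λ m → suc (2 ℕ.* m)) (trans (sym (proj₂ (ℕP.m≤n⇒∃[o]m+o≡n α<γ))) (sym (ℕP.+-suc α δ))))

  reduced-intro : ∀ {z a b c} → c1 z ≡ + a → c2 z ≡ + b → c3 z ≡ + c →
                  a ℕ.≤ 2 ℕ.* α → b ℕ.≤ l1 ℕ.+ 2 → c ℕ.≤ 2 ℕ.* (α ℕ.+ suc δ) → Reduced z
  reduced-intro z1≡a z2≡b z3≡c a≤ b≤ c≤ = reduced z1≡a z2≡b z3≡c
    (subst (_ ℕ.<_) (sym l1≡1+2α) (ℕ.s≤s a≤)) (ℕP.≤-<-trans b≤ gap) (subst (_ ℕ.<_) (sym l3≡1+2[α+1+δ]) (ℕ.s≤s c≤))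

  oddPoint : ℕ → ℕ → Z4
  oddPoint t e = ⟨ + e , + suc (2 ℕ.* t) , + (e ℕ.+ suc δ) , + 1 ⟩

  module _ {t e : ℕ} (t+e≡α : t ℕ.+ e ≡ α) where

    ν·oddPoint : ν · oddPoint t e ≡ + suc (2 ℕ.* t)
    ν·oddPoint = begin
      ν · oddPoint t e
        ≡⟨ cong₂ (λ u v → ν · ⟨ + e , u , v , + 1 ⟩) (pos-odd t) (ℤP.pos-+ e (suc δ)) ⟩
      facetNormal (+ l1) (+ l2) (+ l3) · ⟨ + e , + 1 ℤ.+ + 2 ℤ.* + t , + e ℤ.+ + suc δ , + 1 ⟩
        ≡⟨ halve (trans (twice-height-oddPoint (+ l2) (+ t) (+ e) (+ suc δ) l1≡ l3≡) (cong ((+ 1 ℤ.+ + 2 ℤ.* + t) ℤ.*_) eqn)) ⟩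
      + 1 ℤ.+ + 2 ℤ.* + t
        ≡⟨ pos-odd t ⟨
      + suc (2 ℕ.* t) ∎
      where
      open ≡-Reasoning
      l1≡ : + l1 ≡ + 1 ℤ.+ + 2 ℤ.* (+ t ℤ.+ + e)
      l1≡ = trans (cong +_ (trans l1≡1+2α (cong (λ m → suc (2 ℕ.* m)) (sym t+e≡α)))) (trans (pos-odd (t ℕ.+ e)) (cong (λ m → + 1 ℤ.+ + 2 ℤ.* m) (ℤP.pos-+ t e)))
      l3≡ : + l3 ≡ + 1 ℤ.+ + 2 ℤ.* (+ t ℤ.+ + e ℤ.+ + suc δ)
      l3≡ = trans (cong +_ (trans l3≡1+2[α+1+δ] (cong (λ m → suc (2 ℕ.* (m ℕ.+ suc δ))) (sym t+e≡α))))
                  (trans (pos-odd (t ℕ.+ e ℕ.+ suc δ)) (cong (λ m → + 1 ℤ.+ + 2 ℤ.* m) (trans (ℤP.pos-+ (t ℕ.+ e) (suc δ)) (cong (ℤ._+ + suc δ) (ℤP.pos-+ t e)))))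

    oddPoint-reduced : Reduced (oddPoint t e)
    oddPoint-reduced = reduced-intro refl refl refl
      (ℕP.≤-trans (m+n≡o⇒n≤o t+e≡α) (ℕP.m≤m+n α (α ℕ.+ 0)))
      (ℕP.≤-trans (subst (suc (2 ℕ.* t) ℕ.≤_) (sym l1≡1+2α) (ℕ.s≤s (ℕP.*-monoʳ-≤ 2 {t} {α} (m+n≡o⇒m≤o t+e≡α)))) (ℕP.m≤m+n l1 2))
      (ℕP.≤-trans (ℕP.+-monoˡ-≤ (suc δ) (m+n≡o⇒n≤o t+e≡α)) (ℕP.m≤m+n (α ℕ.+ suc δ) (α ℕ.+ suc δ ℕ.+ 0)))

    oddPoint-generator : Generator l1 l2 l3 (oddPoint t e)
    oddPoint-generator = generator-intro′ (0≤+ e) (0≤+ _) (0≤+ _) refl (subst (+ 0 ℤ.≤_) (sym ν·oddPoint) (0≤+ _))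

  module _ {t e : ℕ} (t+e≡α : t ℕ.+ e ≡ α) where

    evenPoint : Z4
    evenPoint = oddPoint 0 α ⊕ oddPoint t e

    ν·evenPoint : ν · evenPoint ≡ + (2 ℕ.* suc t)
    ν·evenPoint = begin
      ν · evenPoint                          ≡⟨ ·-distribˡ-⊕ ν (oddPoint 0 α) (oddPoint t e) ⟩
      ν · oddPoint 0 α ℤ.+ ν · oddPoint t e  ≡⟨ cong₂ ℤ._+_ (ν·oddPoint {0} {α} refl) (ν·oddPoint t+e≡α) ⟩
      + 1 ℤ.+ + suc (2 ℕ.* t)                ≡⟨ ℤP.pos-+ 1 (suc (2 ℕ.* t)) ⟨
      + suc (suc (2 ℕ.* t))                  ≡⟨ cong +_ (identity t) ⟩
      + (2 ℕ.* suc t)                        ∎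
      where
      open ≡-Reasoning
      identity : ∀ t → suc (suc (2 ℕ.* t)) ≡ 2 ℕ.* suc t
      identity = ℕ-Solver.solve-∀

    evenPoint-reduced : Reduced evenPoint
    evenPoint-reduced = reduced-intro (sym (ℤP.pos-+ α e)) (sym (ℤP.pos-+ 1 (suc (2 ℕ.* t)))) (sym (ℤP.pos-+ (α ℕ.+ suc δ) (e ℕ.+ suc δ)))
      (ℕP.+-monoʳ-≤ α (ℕP.≤-trans (m+n≡o⇒n≤o t+e≡α) (ℕP.m≤m+n α 0)))
      (subst (suc (suc (2 ℕ.* t)) ℕ.≤_) (ℕP.+-comm 2 l1)
        (ℕ.s≤s (ℕ.s≤s (subst (2 ℕ.* t ℕ.≤_) (sym l1≡1+2α) (ℕP.m≤n⇒m≤1+n (ℕP.*-monoʳ-≤ 2 {t} {α} (m+n≡o⇒m≤o t+e≡α)))))))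
      (ℕP.+-monoʳ-≤ (α ℕ.+ suc δ) (ℕP.≤-trans (ℕP.+-monoˡ-≤ (suc δ) (m+n≡o⇒n≤o t+e≡α)) (ℕP.m≤m+n (α ℕ.+ suc δ) 0)))

    InQ-evenPoint : InQ l1 l2 l3 evenPoint
    InQ-evenPoint = InQ-⊕ l1 l2 l3 (InQ-generator l1 l2 l3 (oddPoint-generator {0} {α} refl)) (InQ-generator l1 l2 l3 (oddPoint-generator t+e≡α))

  low-height-point : ∀ {n} → n ℕ.< l1 ℕ.+ 2 →
    Σ Z4 λ p → InQ l1 l2 l3 p × Reduced p × (ν · p ≡ + n) × (c4 p ≡ + 1 → Odd n)
  low-height-point {n} n<l1+2 with even-or-odd n
  ... | inj₁ (zero , refl) =
    zero4 , q-zero , reduced refl refl refl (ℕ.>-nonZero⁻¹ l1) (ℕ.>-nonZero⁻¹ l2) (ℕ.>-nonZero⁻¹ l3) , ·-zeroʳ ν , λ ()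
  ... | inj₁ (suc t , refl) with (e , t+e≡α) ← ℕP.m≤n⇒∃[o]m+o≡n (even<⇒≤ {t} {α} (subst (λ l → 2 ℕ.* suc t ℕ.< l ℕ.+ 2) l1≡1+2α n<l1+2)) =
    evenPoint {t} t+e≡α , InQ-evenPoint {t} t+e≡α , evenPoint-reduced {t} t+e≡α , ν·evenPoint {t} t+e≡α , λ ()
  ... | inj₂ (t , refl) with (e , t+e≡α) ← ℕP.m≤n⇒∃[o]m+o≡n (odd<⇒≤ {t} {α} (subst (λ l → suc (2 ℕ.* t) ℕ.< l ℕ.+ 2) l1≡1+2α n<l1+2)) =
    oddPoint t e , InQ-generator l1 l2 l3 (oddPoint-generator {t} t+e≡α) , oddPoint-reduced {t} t+e≡α , ν·oddPoint {t} t+e≡α , λ _ → t , refl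

  reduced-low-height : ∀ {z n} → Reduced z → ν · z ≡ + n → n ℕ.< l1 ℕ.+ 2 →
                       InQ l1 l2 l3 z × (c4 z ≡ + 1 → Odd n)
  reduced-low-height rz ν·z≡n n<l1+2 with p , qp , rp , ν·p≡n , odd ← low-height-point n<l1+2 =
    subst (InQ l1 l2 l3) (sym z≡p) qp , λ z4≡1 → odd (trans (cong c4 (sym z≡p)) z4≡1)
    where
    z≡p = reduced-unique rz rp (trans ν·z≡n (sym ν·p≡n))

  InQ-of-low-height : ∀ {z n} → + 0 ℤ.≤ c1 z → + 0 ℤ.≤ c2 z → + 0 ℤ.≤ c3 z →
                      ν · z ≡ + n → n ℕ.< l1 ℕ.+ 2 → InQ l1 l2 l3 z
  InQ-of-low-height 0≤z1 0≤z2 0≤z3 ν·z≡n n<l1+2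
    with r , reduced-r , ν·r≡ν·z , InQ-r⇒InQ-z ←
         reduce (sym (ℤP.0≤i⇒+∣i∣≡i 0≤z1)) (sym (ℤP.0≤i⇒+∣i∣≡i 0≤z2)) (sym (ℤP.0≤i⇒+∣i∣≡i 0≤z3)) =
    InQ-r⇒InQ-z (proj₁ (reduced-low-height reduced-r (trans ν·r≡ν·z ν·z≡n) n<l1+2))

  hole-height-bound : ∀ q → Hole l1 l2 l3 q → + (l1 ℕ.+ 2) ℤ.≤ σ l1 l2 l3 q
  hole-height-bound q (q∈cone , q∉Q) with + (l1 ℕ.+ 2) ℤP.≤? σ l1 l2 l3 q
  ... | yes bound = bound
  ... | no ¬bound = ⊥-elim (q∉Q (InQ-of-low-height 0≤q1 0≤q2 0≤q3 (sym (ℤP.0≤i⇒+∣i∣≡i 0≤ν·q)) ∣ν·q∣<l1+2))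
    where
    q-coordinates = InCone⇒nonNeg-coordinates l1 l2 l3 {q} q∈cone
    0≤q1 = proj₁ q-coordinates
    0≤q2 = proj₁ (proj₂ q-coordinates)
    0≤q3 = proj₂ (proj₂ q-coordinates)
    0≤ν·q : + 0 ℤ.≤ ν · q
    0≤ν·q = InCone-nonNeg l1 l2 l3 ν (InQ-nonNeg l1 l2 l3 ν generator⇒ν·-nonNeg) q∈cone
    ∣ν·q∣<l1+2 : ℤ.∣ ν · q ∣ ℕ.< l1 ℕ.+ 2
    ∣ν·q∣<l1+2 with ℤ.+<+ lt ← subst (ℤ._< + (l1 ℕ.+ 2)) (trans (σ≡ν· q) (sym (ℤP.0≤i⇒+∣i∣≡i 0≤ν·q))) (ℤP.≰⇒> ¬bound) = lt

  hole : Z4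
  hole = ⟨ + (2 ℕ.* α) , + (l1 ℕ.+ 2) , + δ , + 2 ⟩

  ν·hole : ν · hole ≡ + (l1 ℕ.+ 2)
  ν·hole = begin
    ν · hole
      ≡⟨ cong₂ (λ u v → ν · ⟨ u , v , + δ , + 2 ⟩) (pos-even α) (ℤP.pos-+ l1 2) ⟩
    ν · ⟨ + 2 ℤ.* + α , + l1 ℤ.+ + 2 , + δ , + 2 ⟩
      ≡⟨ halve (trans (twice-height-hole (+ l2) (+ α) (+ δ) l1≡ l3≡) (cong ((+ l1 ℤ.+ + 2) ℤ.*_) eqn)) ⟩
    + l1 ℤ.+ + 2
      ≡⟨ ℤP.pos-+ l1 2 ⟨
    + (l1 ℕ.+ 2) ∎
    where
    open ≡-Reasoning
    l1≡ : + l1 ≡ + 1 ℤ.+ + 2 ℤ.* + α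
    l1≡ = trans (cong +_ l1≡1+2α) (pos-odd α)
    l3≡ : + l3 ≡ + 1 ℤ.+ + 2 ℤ.* (+ α ℤ.+ (+ 1 ℤ.+ + δ))
    l3≡ = trans (cong +_ l3≡1+2[α+1+δ]) (trans (pos-odd (α ℕ.+ suc δ))
            (cong (λ m → + 1 ℤ.+ + 2 ℤ.* m) (trans (ℤP.pos-+ α (suc δ)) (cong (ℤ._+_ (+ α)) (ℤP.pos-+ 1 δ)))))

  hole-InCone : InCone l1 l2 l3 hole
  hole-InCone = InCone-intro (0≤+ _) (0≤+ _) (0≤+ _) (subst (+ 0 ℤ.≤_) (sym ν·hole) (0≤+ _))

  hole-summands-reduced : ∀ {x y} → Generator l1 l2 l3 x → Generator l1 l2 l3 y → hole ≡ x ⊕ (y ⊕ zero4) →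
                          Reduced x × Reduced y
  hole-summands-reduced ((0≤x1 , 0≤x2 , 0≤x3 , _) , _) ((0≤y1 , 0≤y2 , 0≤y3 , _) , _) hole≡x⊕y
    with a₁ , b₁ , x1≡ , y1≡ , a₁+b₁ ← nonNeg-summands 0≤x1 0≤y1 (sym (cong c1 hole≡x⊕y))
       | a₂ , b₂ , x2≡ , y2≡ , a₂+b₂ ← nonNeg-summands 0≤x2 0≤y2 (sym (cong c2 hole≡x⊕y))
       | a₃ , b₃ , x3≡ , y3≡ , a₃+b₃ ← nonNeg-summands 0≤x3 0≤y3 (sym (cong c3 hole≡x⊕y)) =
    reduced-intro x1≡ x2≡ x3≡ (m+n≡o⇒m≤o a₁+b₁) (m+n≡o⇒m≤o a₂+b₂) (ℕP.≤-trans (m+n≡o⇒m≤o a₃+b₃) δ≤) ,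
    reduced-intro y1≡ y2≡ y3≡ (m+n≡o⇒n≤o a₁+b₁) (m+n≡o⇒n≤o a₂+b₂) (ℕP.≤-trans (m+n≡o⇒n≤o a₃+b₃) δ≤)
    where
    δ≤ : δ ℕ.≤ 2 ℕ.* (α ℕ.+ suc δ)
    δ≤ = ℕP.≤-trans (ℕP.n≤1+n δ) (ℕP.≤-trans (ℕP.m≤n+m (suc δ) α) (ℕP.m≤m+n (α ℕ.+ suc δ) (α ℕ.+ suc δ ℕ.+ 0)))

  hole-summand-heights : ∀ {g g′} → hole ≡ g ⊕ (g′ ⊕ zero4) → ν · g ℤ.+ (ν · g′ ℤ.+ + 0) ≡ + (l1 ℕ.+ 2)
  hole-summand-heights {g} {g′} hole≡g⊕g′ = begin
    ν · g ℤ.+ (ν · g′ ℤ.+ + 0)      ≡⟨ cong (λ u → ν · g ℤ.+ (ν · g′ ℤ.+ u)) (·-zeroʳ ν) ⟨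
    ν · g ℤ.+ (ν · g′ ℤ.+ ν · zero4) ≡⟨ cong (ℤ._+_ (ν · g)) (·-distribˡ-⊕ ν g′ zero4) ⟨
    ν · g ℤ.+ ν · (g′ ⊕ zero4)       ≡⟨ ·-distribˡ-⊕ ν g (g′ ⊕ zero4) ⟨
    ν · (g ⊕ (g′ ⊕ zero4))           ≡⟨ cong (ν ·_) hole≡g⊕g′ ⟨
    ν · hole                         ≡⟨ ν·hole ⟩
    + (l1 ℕ.+ 2)                     ∎
    where open ≡-Reasoning

  hole∉Q : ¬ InQ l1 l2 l3 hole
  hole∉Q hole∈Q with g , g′ , G , G′ , hole≡g⊕g′ ← InQ-level-two l1 l2 l3 hole∈Q refl
    with s₁ , s₂ , ν·g≡s₁ , ν·g′≡s₂ , s₁+s₂≡l1+2 ← nonNeg-summands (generator⇒ν·-nonNeg G) (generator⇒ν·-nonNeg G′) (hole-summand-heights hole≡g⊕g′)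
    with reduced-g , reduced-g′ ← hole-summands-reduced G G′ hole≡g⊕g′ =
    odd-not-sum-of-two-odd (suc α , trans (cong (ℕ._+ 2) l1≡1+2α) (odd+2 α)) s₁+s₂≡l1+2
      (λ s₁<l1+2 → proj₂ (reduced-low-height reduced-g ν·g≡s₁ s₁<l1+2) (proj₂ G))
      (λ s₂<l1+2 → proj₂ (reduced-low-height reduced-g′ ν·g′≡s₂ s₂<l1+2) (proj₂ G′))

proposition4p4 : (l1 l2 l3 : ℕ) .{{_ : NonZero l1}} .{{_ : NonZero l2}} .{{_ : NonZero l3}} →
    GoodTriple l1 l2 l3 →
      ¬ Normal l1 l2 l3 ×
      (∀ q → Hole l1 l2 l3 q → + (l1 ℕ.+ 2) ℤ.≤ σ l1 l2 l3 q)
proposition4p4 l1 l2 l3 good = (λ normal → hole∉Q (normal hole hole-InCone)) , hole-height-bound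
  where open GoodTripleTheory l1 l2 l3 good
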